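{- Let $d\geq 3$ and $k\geq 1$ be integers, and let $p_{d,k,n}$ be the number of directed plateau polyhypercubes of dimension $d$, width $k$ and lateral area $n$. Then for $n\geq (d-1)k$, $$p_{d,k,n}=\binom{n+(d-1)k-d}{n-(d-1)k}.$$
   Context: Work in $\mathbb{Z}^d$ with orthonormal coordinate system $(0,\vec{i_1},\dots,\vec{i_d})$. A cell is a unit hypercube with integer vertices. A polyhypercube of dimension $d$ is a finite union of cells, connected through their $(d-1)$-dimensional faces, defined up to translation. An elementary step is a positive move of one unit along one of the axes $\vec{i_j}$. A polyhypercube is directed if there is a root cell from which every cell can be reached by a path of cells made only of elementary steps. The width is the number of strata, a stratum being the set of cells with a given $\vec{i_1}$-coordinate. A plateau is a stratum that is a hyperrectangle (box) of cells; a directed plateau polyhypercube is a directed polyhypercube all of whose strata are plateaus. The lateral area of a polyhypercube is the sum, over $2\leq l\leq d$, of the areas (numbers of unit squares) of the polyominoes obtained by projecting it onto the planes $(\vec{i_1},\vec{i_l})$. -}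

module Defs where

open import Data.Nat as ℕ using (ℕ; zero; suc)
open import Data.Integer as ℤ using (ℤ; 0ℤ; 1ℤ)
import Data.Integer.Properties as ℤP
open import Data.Fin using (Fin)
open import Data.Vec as Vec using (Vec; []; _∷_; lookup; zipWith; updateAt)
open import Data.List as List using (List; length; map; deduplicate; allFin; drop)
open import Data.Nat.ListAction using (sum)
open import Data.List.Membership.Propositional using (_∈_)
open import Data.Product using (Σ; ∃; ∃-syntax; _×_; _,_)
open import Data.Product.Properties as ×P using ()
open import Function.Bundles using (_⇔_)
open import Relation.Binary.PropositionalEquality using (_≡_)

-- A cell of ℤ^d is identified with its lower corner (integer vertex).
Cell : ℕ → Set
Cell d = Vec ℤ d

-- A finite union of cells, represented by a list of cells
-- (set semantics: only membership matters; duplicates are harmless).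
CellSet : ℕ → Set
CellSet d = List (Cell d)

-- First coordinate (along i₁); d ≥ 3 in the theorem so the [] case is irrelevant.
first : ∀ {d} → Cell d → ℤ
first []      = 0ℤ
first (x ∷ _) = x

ElemStep : ∀ {d} → Cell d → Cell d → Set
ElemStep {d} a b = ∃[ j ] (b ≡ updateAt a j (ℤ._+ 1ℤ))

data Path {d} (P : CellSet d) : Cell d → Cell d → Set where
  here : ∀ {c} → Path P c c
  step : ∀ {a b c} → ElemStep a b → b ∈ P → Path P b c → Path P a c

-- Directed: a root cell from which every cell is reachable.
-- (Directedness implies face-connectedness, and nonemptiness.)
Directed : ∀ {d} → CellSet d → Set
Directed P = ∃[ r ] (r ∈ P × (∀ c → c ∈ P → Path P r c))

InBox : ∀ {d} → Cell d → Cell d → Cell d → Set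
InBox lo hi c = ∀ j → (lookup lo j ℤ.≤ lookup c j) × (lookup c j ℤ.≤ lookup hi j)

AllPlateaus : ∀ {d} → CellSet d → Set
AllPlateaus {d} P =
  ∀ (a : ℤ) → (∃[ c ] (c ∈ P × first c ≡ a)) →
  ∃[ lo ] ∃[ hi ] (∀ (c : Cell d) → first c ≡ a → (c ∈ P ⇔ InBox lo hi c))

DirectedPlateau : ∀ {d} → CellSet d → Set
DirectedPlateau P = Directed P × AllPlateaus P

width : ∀ {d} → CellSet d → ℕ
width P = length (deduplicate ℤ._≟_ (map first P))

projArea : ∀ {d} → CellSet d → Fin d → ℕ
projArea P l = length (deduplicate (×P.≡-dec ℤ._≟_ ℤ._≟_) (map (λ c → (first c , lookup c l)) P))

-- Lateral area: sum over l = 2..d (Fin indices 1..d-1).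
lateralArea : ∀ {d} → CellSet d → ℕ
lateralArea {d} P = sum (map (projArea P) (drop 1 (allFin d)))

_∼_ : ∀ {d} → CellSet d → CellSet d → Set
_∼_ {d} P Q = ∃[ t ] (∀ (c : Cell d) → (c ∈ P ⇔ zipWith ℤ._+_ c t ∈ Q))

DPP : (d k n : ℕ) → CellSet d → Set
DPP d k n P = DirectedPlateau P × width P ≡ k × lateralArea P ≡ n

-- "The number of ∼-classes of elements satisfying S is N":
-- N pairwise inequivalent representatives covering all of S.
NumClasses : {A : Set} → (A → A → Set) → (A → Set) → ℕ → Set
NumClasses {A} _≈_ S N =
  Σ (Fin N → A) λ L →
    (∀ i → S (L i)) ×
    (∀ i j → L i ≈ L j → i ≡ j) ×
    (∀ x → S x → ∃[ i ] (x ≈ L i))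

-- Translate a directed plateau polyhypercube of width k so that its root is the origin. Its
-- strata are then k boxes stacked along the first axis: the box of level 0 has its lower corner
-- at the origin, and since the least cell of level a + 1 can only be entered from level a, the
-- lower corner of each box lies on the box below. Such a stack is coded by the offset o ≥ 0 of
-- each lower corner from the one below, the remaining extent r of the box below beyond it, and
-- the extent e of the top box: (d - 1)(2k - 1) natural numbers. Every code gives a directed
-- plateau polyhypercube, distinct codes give non-translates, and as a box of extents e
-- contributes e_l + 1 to the projection on the plane (i₁, i_l), the lateral area is
-- (d - 1)k plus the sum of the code. So p_{d,k,n} counts the weak compositions of n - (d - 1)k
-- into (d - 1)(2k - 1) parts.

module Submission where

open import Data.Nat as ℕ using (ℕ; zero; suc; _+_; _*_; _∸_; _≤_; _<_; z≤n; s≤s)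
import Data.Nat.Properties as ℕP
open import Algebra.Properties.CommutativeSemigroup ℕP.+-commutativeSemigroup using (interchange)
open import Data.Nat.Combinatorics using (_C_; nCn≡1; nCk+nC[k+1]≡[n+1]C[k+1])
open import Data.Fin using (Fin; zero; suc)
open import Data.List as List
  using (List; []; _∷_; _++_; length; map; deduplicate; applyUpTo; cartesianProductWith)
open import Data.List.Properties
  using (length-map; length-++; length-applyUpTo; map-tabulate; tabulate-cong; map-cong)
open import Data.List.Membership.Propositional using (_∈_)
open import Data.List.Membership.Propositional.Properties
  using ( ∈-map⁺; ∈-map⁻; ∈-++⁺ˡ; ∈-++⁺ʳ; ∈-++⁻; ∈-deduplicate⁺; ∈-deduplicate⁻; ∈-lookup
        ; ∈-applyUpTo⁺; ∈-applyUpTo⁻; ∈-cartesianProductWith⁺; ∈-cartesianProductWith⁻)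
open import Data.List.Membership.Propositional.Properties.WithK using (unique∧set⇒bag)
open import Data.List.Relation.Binary.BagAndSetEquality using (∼bag⇒↭)
open import Data.List.Relation.Binary.Permutation.Propositional.Properties using (↭-length)
open import Data.List.Relation.Unary.All as All using ([])
open import Data.List.Relation.Unary.AllPairs using ([]; _∷_)
open import Data.List.Relation.Unary.Any as Any using (here)
import Data.List.Relation.Unary.Any.Properties as Any
open import Data.List.Relation.Unary.Unique.Propositional using (Unique)
import Data.List.Relation.Unary.Unique.Propositional.Properties as Unique
open import Data.List.Relation.Unary.Unique.DecPropositional.Properties using (deduplicate-!)
open import Data.Integer as ℤ using (ℤ; 0ℤ; 1ℤ; +_; +≤+)
import Data.Integer.Properties as ℤP
import Data.List.Extrema ℤP.≤-totalOrder as Extrema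
open import Data.Integer.Tactic.RingSolver using (solve-∀)
open import Data.Nat.Tactic.RingSolver using () renaming (solve-∀ to solve-∀ℕ)
open import Data.Nat.ListAction using (sum)
open import Data.Vec as Vec using (Vec; []; _∷_; replicate; zipWith; updateAt)
import Data.Vec.Properties as VecP
open import Data.Vec.Relation.Binary.Pointwise.Inductive as Pointwise using (Pointwise; []; _∷_)
import Data.Vec.Relation.Binary.Pointwise.Extensional as Extensional
import Data.Product.Properties as ×P
open import Data.Product using (Σ; _×_; _,_; _,′_; proj₁; proj₂; uncurry)
open import Data.Sum using (_⊎_; inj₁; inj₂)
open import Data.Empty using (⊥; ⊥-elim)
open import Function.Base using (_∘_)
open import Function.Bundles using (_⇔_; mk⇔; Equivalence)
open import Function.Construct.Composition using (_⇔-∘_)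
open import Function.Construct.Symmetry using (⇔-sym)
open import Relation.Binary.Definitions using (DecidableEquality)
open import Relation.Binary.PropositionalEquality
open import Relation.Nullary using (yes; no)
open import Defs

private variable n : ℕ

module _ {A : Set} where

  length-deduplicate : (_≟_ : DecidableEquality A) (xs ys : List A) → Unique ys →
    (∀ {z} → z ∈ xs → z ∈ ys) → (∀ {z} → z ∈ ys → z ∈ xs) →
    length (deduplicate _≟_ xs) ≡ length ys
  length-deduplicate _≟_ xs ys ys! xs⊆ys ys⊆xs =
    ↭-length (∼bag⇒↭ (unique∧set⇒bag (deduplicate-! _≟_ xs) ys!
      (mk⇔ (λ p → xs⊆ys (∈-deduplicate⁻ _≟_ xs p)) (λ p → ∈-deduplicate⁺ _≟_ (ys⊆xs p)))))

  lookup-injective : {xs : List A} → Unique xs → (i j : Fin (length xs)) →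
    List.lookup xs i ≡ List.lookup xs j → i ≡ j
  lookup-injective (_ ∷ _)  zero    zero    _  = refl
  lookup-injective (x∉ ∷ _) zero    (suc j) eq = ⊥-elim (All.lookup x∉ (∈-lookup j) eq)
  lookup-injective (x∉ ∷ _) (suc i) zero    eq = ⊥-elim (All.lookup x∉ (∈-lookup i) (sym eq))
  lookup-injective (_ ∷ xs!) (suc i) (suc j) eq = cong suc (lookup-injective xs! i j eq)

NumClasses-enumeration : {A B : Set} {_≈_ : A → A → Set} {S : A → Set} (f : B → A) (xs : List B) →
  Unique xs → (∀ {b} → b ∈ xs → S (f b)) → (∀ b b′ → f b ≈ f b′ → b ≡ b′) →
  (∀ a → S a → Σ B λ b → b ∈ xs × a ≈ f b) → NumClasses _≈_ S (length xs)
NumClasses-enumeration {_≈_ = _≈_} f xs xs! S-image f-injective cover =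
  f ∘ List.lookup xs ,
  (λ i → S-image (∈-lookup i)) ,
  (λ i i′ eq → lookup-injective xs! i i′ (f-injective _ _ eq)) ,
  λ a a∈S → let (b , b∈ , a≈fb) = cover a a∈S in
    Any.index b∈ , subst (λ b′ → a ≈ f b′) (Any.lookup-index b∈) a≈fb

incrementHead : ∀ {p} → Vec ℕ (suc p) → Vec ℕ (suc p)
incrementHead (x ∷ xs) = suc x ∷ xs

compositions : (p m : ℕ) → List (Vec ℕ p)
compositions zero    zero    = [] ∷ []
compositions zero    (suc m) = []
compositions (suc p) zero    = map (0 ∷_) (compositions p zero)
compositions (suc p) (suc m) =
  map (0 ∷_) (compositions p (suc m)) ++ map incrementHead (compositions (suc p) m)

length-compositions : ∀ q m → length (compositions (suc q) m) ≡ (m + q) C m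
length-compositions zero zero = refl
length-compositions zero (suc m) = begin
  length (map incrementHead (compositions 1 m)) ≡⟨ length-map incrementHead (compositions 1 m) ⟩
  length (compositions 1 m)                     ≡⟨ length-compositions zero m ⟩
  (m + 0) C m                                   ≡⟨ cong (_C m) (ℕP.+-identityʳ m) ⟩
  m C m                                         ≡⟨ trans (nCn≡1 m) (sym (nCn≡1 (suc m))) ⟩
  suc m C suc m                                 ≡⟨ cong (_C suc m) (ℕP.+-identityʳ (suc m)) ⟨
  (suc m + 0) C suc m                           ∎
  where open ≡-Reasoning
length-compositions (suc q) zero =
  trans (length-map (0 ∷_) (compositions (suc q) zero)) (length-compositions q zero)
length-compositions (suc q) (suc m) = begin
  length (map (0 ∷_) left ++ map incrementHead right)
    ≡⟨ length-++ (map (0 ∷_) left) ⟩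
  length (map (0 ∷_) left) + length (map incrementHead right)
    ≡⟨ cong₂ _+_ (length-map (0 ∷_) left) (length-map incrementHead right) ⟩
  length left + length right
    ≡⟨ cong₂ _+_ (length-compositions q (suc m)) (length-compositions (suc q) m) ⟩
  (suc m + q) C suc m + (m + suc q) C m
    ≡⟨ cong (λ z → z C suc m + (m + suc q) C m) (ℕP.+-suc m q) ⟨
  (m + suc q) C suc m + (m + suc q) C m
    ≡⟨ ℕP.+-comm ((m + suc q) C suc m) _ ⟩
  (m + suc q) C m + (m + suc q) C suc m
    ≡⟨ nCk+nC[k+1]≡[n+1]C[k+1] (m + suc q) m ⟩
  (suc m + suc q) C suc m ∎
  where
  open ≡-Reasoning
  left = compositions (suc q) (suc m)
  right = compositions (suc (suc q)) m

∈-compositions⁻ : ∀ p m {v} → v ∈ compositions p m → Vec.sum v ≡ m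
∈-compositions⁻ zero zero (here refl) = refl
∈-compositions⁻ (suc p) zero v∈ with ∈-map⁻ (0 ∷_) v∈
... | _ , v∈′ , refl = ∈-compositions⁻ p zero v∈′
∈-compositions⁻ (suc p) (suc m) v∈ with ∈-++⁻ (map (0 ∷_) (compositions p (suc m))) v∈
... | inj₁ v∈ˡ with ∈-map⁻ (0 ∷_) v∈ˡ
...   | _ , v∈′ , refl = ∈-compositions⁻ p (suc m) v∈′
∈-compositions⁻ (suc p) (suc m) v∈ | inj₂ v∈ʳ with ∈-map⁻ incrementHead v∈ʳ
...   | _ ∷ _ , v∈′ , refl = cong suc (∈-compositions⁻ (suc p) m v∈′)

∈-compositions⁺ : ∀ p m (v : Vec ℕ p) → Vec.sum v ≡ m → v ∈ compositions p m
∈-compositions⁺ zero    zero    []           _  = here refl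
∈-compositions⁺ (suc p) zero    (zero ∷ v)   eq = ∈-map⁺ (0 ∷_) (∈-compositions⁺ p zero v eq)
∈-compositions⁺ (suc p) (suc m) (zero ∷ v)   eq =
  ∈-++⁺ˡ (∈-map⁺ (0 ∷_) (∈-compositions⁺ p (suc m) v eq))
∈-compositions⁺ (suc p) (suc m) (suc x ∷ v) eq = ∈-++⁺ʳ (map (0 ∷_) (compositions p (suc m)))
  (∈-map⁺ incrementHead (∈-compositions⁺ (suc p) m (x ∷ v) (ℕP.suc-injective eq)))

compositions-unique : ∀ p m → Unique (compositions p m)
compositions-unique zero    zero    = [] ∷ []
compositions-unique zero    (suc m) = []
compositions-unique (suc p) zero    = Unique.map⁺ VecP.∷-injectiveʳ (compositions-unique p zero)
compositions-unique (suc p) (suc m) = Unique.++⁺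
  (Unique.map⁺ VecP.∷-injectiveʳ (compositions-unique p (suc m)))
  (Unique.map⁺ incrementHead-injective (compositions-unique (suc p) m))
  disjoint
  where
  incrementHead-injective : ∀ {u v : Vec ℕ (suc p)} → incrementHead u ≡ incrementHead v → u ≡ v
  incrementHead-injective {_ ∷ _} {_ ∷ _} refl = refl
  disjoint : ∀ {v} →
    v ∈ map (0 ∷_) (compositions p (suc m)) × v ∈ map incrementHead (compositions (suc p) m) → ⊥
  disjoint (v∈ˡ , v∈ʳ) with ∈-map⁻ (0 ∷_) v∈ˡ | ∈-map⁻ incrementHead v∈ʳ
  ... | _ , _ , refl | _ ∷ _ , _ , ()

infixl 6 _⊕_ _⊖_
infix 4 _≤ᵥ_

_⊕_ : Vec ℤ n → Vec ℤ n → Vec ℤ n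
_⊕_ = zipWith ℤ._+_

_⊖_ : Vec ℤ n → Vec ℤ n → Vec ℤ n
x ⊖ t = x ⊕ Vec.map ℤ.-_ t

0ᵥ : ∀ {n} → Vec ℤ n
0ᵥ {n} = replicate n 0ℤ

+ᵥ_ : Vec ℕ n → Vec ℤ n
+ᵥ_ = Vec.map (λ k → + k)

∣_∣ᵥ : Vec ℤ n → Vec ℕ n
∣_∣ᵥ = Vec.map ℤ.∣_∣

_≤ᵥ_ : Vec ℤ n → Vec ℤ n → Set
_≤ᵥ_ = Pointwise ℤ._≤_

Within : Vec ℤ n → Vec ℤ n → Vec ℤ n → Set
Within lo hi y = lo ≤ᵥ y × y ≤ᵥ hi

≤ᵥ-refl : {a : Vec ℤ n} → a ≤ᵥ a
≤ᵥ-refl = Pointwise.refl ℤP.≤-refl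

≤ᵥ-trans : {a b c : Vec ℤ n} → a ≤ᵥ b → b ≤ᵥ c → a ≤ᵥ c
≤ᵥ-trans = Pointwise.trans ℤP.≤-trans

private
  i-j+j≡i : ∀ (i j : ℤ) → i ℤ.- j ℤ.+ j ≡ i
  i-j+j≡i = solve-∀

  i+j-j≡i : ∀ (i j : ℤ) → i ℤ.+ j ℤ.- j ≡ i
  i+j-j≡i = solve-∀

  j+[i-j]≡i : ∀ (i j : ℤ) → j ℤ.+ (i ℤ.- j) ≡ i
  j+[i-j]≡i = solve-∀

  i+1+j≡i+j+1 : ∀ (i j : ℤ) → i ℤ.+ 1ℤ ℤ.+ j ≡ i ℤ.+ j ℤ.+ 1ℤ
  i+1+j≡i+j+1 = solve-∀

  i+[1+j]≡i+1+j : ∀ (i j : ℤ) → i ℤ.+ (1ℤ ℤ.+ j) ≡ i ℤ.+ 1ℤ ℤ.+ j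
  i+[1+j]≡i+1+j = solve-∀

+[1+a]≡+a+1 : ∀ a → + suc a ≡ + a ℤ.+ 1ℤ
+[1+a]≡+a+1 a = cong +_ (ℕP.+-comm 1 a)

i+1≢0 : ∀ {i} → 0ℤ ℤ.≤ i → i ℤ.+ 1ℤ ≢ 0ℤ
i+1≢0 (+≤+ {n = k} _) eq = ℕP.1+n≢0 (trans (ℕP.+-comm 1 k) (ℤP.+-injective eq))

+-cancelʳ-≤ᵢ : ∀ k {i j} → i ℤ.+ k ℤ.≤ j ℤ.+ k → i ℤ.≤ j
+-cancelʳ-≤ᵢ k {i} {j} p = subst₂ ℤ._≤_ (i+j-j≡i i k) (i+j-j≡i j k) (ℤP.+-monoˡ-≤ (ℤ.- k) p)

+-cancelʳ-≡ᵢ : ∀ k {i j} → i ℤ.+ k ≡ j ℤ.+ k → i ≡ j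
+-cancelʳ-≡ᵢ k {i} {j} eq = trans (sym (i+j-j≡i i k)) (trans (cong (ℤ._- k) eq) (i+j-j≡i j k))

≤ᵥ-antisym : {a b : Vec ℤ n} → a ≤ᵥ b → b ≤ᵥ a → a ≡ b
≤ᵥ-antisym []       []       = refl
≤ᵥ-antisym (p ∷ ps) (q ∷ qs) = cong₂ _∷_ (ℤP.≤-antisym p q) (≤ᵥ-antisym ps qs)

≤ᵥ-first : {a c : Vec ℤ (suc n)} → a ≤ᵥ c → first a ℤ.≤ first c
≤ᵥ-first {a = _ ∷ _} {_ ∷ _} (p ∷ _) = p

≤ᵥ-tail : {a c : Vec ℤ (suc n)} → a ≤ᵥ c → Vec.tail a ≤ᵥ Vec.tail c
≤ᵥ-tail {a = _ ∷ _} {_ ∷ _} (_ ∷ p) = p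

⊕-monoˡ-≤ᵥ : {a b : Vec ℤ n} (t : Vec ℤ n) → a ≤ᵥ b → a ⊕ t ≤ᵥ b ⊕ t
⊕-monoˡ-≤ᵥ (x ∷ t) (p ∷ ps) = ℤP.+-monoˡ-≤ x p ∷ ⊕-monoˡ-≤ᵥ t ps
⊕-monoˡ-≤ᵥ []      []       = []

x⊖t⊕t≡x : (x t : Vec ℤ n) → x ⊖ t ⊕ t ≡ x
x⊖t⊕t≡x []      []      = refl
x⊖t⊕t≡x (x ∷ c) (y ∷ t) = cong₂ _∷_ (i-j+j≡i x y) (x⊖t⊕t≡x c t)

x⊕t⊖t≡x : (x t : Vec ℤ n) → x ⊕ t ⊖ t ≡ x
x⊕t⊖t≡x []      []      = refl
x⊕t⊖t≡x (x ∷ c) (y ∷ t) = cong₂ _∷_ (i+j-j≡i x y) (x⊕t⊖t≡x c t)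

t⊕[x⊖t]≡x : (x t : Vec ℤ n) → t ⊕ (x ⊖ t) ≡ x
t⊕[x⊖t]≡x []      []      = refl
t⊕[x⊖t]≡x (x ∷ c) (y ∷ t) = cong₂ _∷_ (j+[i-j]≡i x y) (t⊕[x⊖t]≡x c t)

x⊖x≡0ᵥ : (x : Vec ℤ n) → x ⊖ x ≡ 0ᵥ
x⊖x≡0ᵥ []      = refl
x⊖x≡0ᵥ (x ∷ t) = cong₂ _∷_ (ℤP.+-inverseʳ x) (x⊖x≡0ᵥ t)

0ᵥ⊕t≡t : (t : Vec ℤ n) → 0ᵥ ⊕ t ≡ t
0ᵥ⊕t≡t []      = refl
0ᵥ⊕t≡t (x ∷ t) = cong₂ _∷_ (ℤP.+-identityˡ x) (0ᵥ⊕t≡t t)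

t⊕0ᵥ≡t : (t : Vec ℤ n) → t ⊕ 0ᵥ ≡ t
t⊕0ᵥ≡t []      = refl
t⊕0ᵥ≡t (x ∷ t) = cong₂ _∷_ (ℤP.+-identityʳ x) (t⊕0ᵥ≡t t)

⊕-cancelˡ-≤ᵥ : {a b : Vec ℤ n} (t : Vec ℤ n) → a ⊕ t ≤ᵥ b ⊕ t → a ≤ᵥ b
⊕-cancelˡ-≤ᵥ {a = a} {b} t p =
  subst₂ _≤ᵥ_ (x⊕t⊖t≡x a t) (x⊕t⊖t≡x b t) (⊕-monoˡ-≤ᵥ (Vec.map ℤ.-_ t) p)

⊕-cancelʳ : {a b : Vec ℤ n} (t : Vec ℤ n) → a ⊕ t ≡ b ⊕ t → a ≡ b
⊕-cancelʳ {a = a} {b} t eq = trans (sym (x⊕t⊖t≡x a t)) (trans (cong (_⊖ t) eq) (x⊕t⊖t≡x b t))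

Within-⊕ : {lo hi y : Vec ℤ n} (t : Vec ℤ n) → Within lo hi y → Within (lo ⊕ t) (hi ⊕ t) (y ⊕ t)
Within-⊕ t (p , q) = ⊕-monoˡ-≤ᵥ t p , ⊕-monoˡ-≤ᵥ t q

Within-⊕⁻ : {lo hi y : Vec ℤ n} (t : Vec ℤ n) → Within (lo ⊕ t) (hi ⊕ t) (y ⊕ t) → Within lo hi y
Within-⊕⁻ t (p , q) = ⊕-cancelˡ-≤ᵥ t p , ⊕-cancelˡ-≤ᵥ t q

Within-⊕⇔ : {lo hi y : Vec ℤ n} (t : Vec ℤ n) → Within lo hi (y ⊕ t) ⇔ Within (lo ⊖ t) (hi ⊖ t) y
Within-⊕⇔ {lo = lo} {hi} t = mk⇔
  (λ y∈ → Within-⊕⁻ t (subst₂ (λ l h → Within l h _) (sym (x⊖t⊕t≡x lo t)) (sym (x⊖t⊕t≡x hi t)) y∈))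
  (λ y∈ → subst₂ (λ l h → Within l h _) (x⊖t⊕t≡x lo t) (x⊖t⊕t≡x hi t) (Within-⊕ t y∈))

Within-∷⇔ : {lo hi : Vec ℤ (suc n)} {x : ℤ} {y : Vec ℤ n} → first lo ℤ.≤ x → x ℤ.≤ first hi →
  Within lo hi (x ∷ y) ⇔ Within (Vec.tail lo) (Vec.tail hi) y
Within-∷⇔ {lo = _ ∷ _} {_ ∷ _} lo≤x x≤hi =
  mk⇔ (λ (p , q) → Pointwise.tail p , Pointwise.tail q) (λ (p , q) → lo≤x ∷ p , x≤hi ∷ q)

0ᵥ≤+ᵥ : (g : Vec ℕ n) → 0ᵥ ≤ᵥ +ᵥ g
0ᵥ≤+ᵥ []      = []
0ᵥ≤+ᵥ (_ ∷ g) = +≤+ z≤n ∷ 0ᵥ≤+ᵥ g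

Within-corners : {lo hi lo′ hi′ : Vec ℤ n} → lo ≤ᵥ hi →
  (∀ y → Within lo hi y ⇔ Within lo′ hi′ y) → lo ≡ lo′ × hi ≡ hi′
Within-corners lo≤hi same = ≤ᵥ-antisym lo≤lo′ lo′≤lo , ≤ᵥ-antisym hi≤hi′ hi′≤hi
  where
  lo′≤lo = proj₁ (Equivalence.to (same _) (≤ᵥ-refl , lo≤hi))
  hi≤hi′ = proj₂ (Equivalence.to (same _) (lo≤hi , ≤ᵥ-refl))
  lo′≤hi′ = ≤ᵥ-trans lo′≤lo (≤ᵥ-trans lo≤hi hi≤hi′)
  lo≤lo′ = proj₁ (Equivalence.from (same _) (≤ᵥ-refl , lo′≤hi′))
  hi′≤hi = proj₂ (Equivalence.from (same _) (lo′≤hi′ , ≤ᵥ-refl))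

0≤t∧0≤-t⇒t≡0 : {t : Vec ℤ n} → 0ᵥ ≤ᵥ t → 0ᵥ ≤ᵥ 0ᵥ ⊖ t → t ≡ 0ᵥ
0≤t∧0≤-t⇒t≡0 {t = t} 0≤t 0≤-t = ≤ᵥ-antisym
  (subst₂ _≤ᵥ_ (0ᵥ⊕t≡t t) (x⊖t⊕t≡x 0ᵥ t) (⊕-monoˡ-≤ᵥ t 0≤-t)) 0≤t

x≤x⊕+ᵥg : (x : Vec ℤ n) (g : Vec ℕ n) → x ≤ᵥ x ⊕ +ᵥ g
x≤x⊕+ᵥg []      []      = []
x≤x⊕+ᵥg (x ∷ a) (k ∷ g) = ℤP.i≤i+j x (+ k) ∷ x≤x⊕+ᵥg a g

+ᵥ∣x∣ᵥ≡x : {x : Vec ℤ n} → 0ᵥ ≤ᵥ x → +ᵥ ∣ x ∣ᵥ ≡ x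
+ᵥ∣x∣ᵥ≡x []       = refl
+ᵥ∣x∣ᵥ≡x (p ∷ ps) = cong₂ _∷_ (ℤP.0≤i⇒+∣i∣≡i p) (+ᵥ∣x∣ᵥ≡x ps)

+ᵥ-injective : {g h : Vec ℕ n} → +ᵥ g ≡ +ᵥ h → g ≡ h
+ᵥ-injective {g = []}    {[]}    _  = refl
+ᵥ-injective {g = _ ∷ _} {_ ∷ _} eq =
  cong₂ _∷_ (ℤP.+-injective (VecP.∷-injectiveˡ eq)) (+ᵥ-injective (VecP.∷-injectiveʳ eq))

+ᵥ-+ : (g h : Vec ℕ n) → +ᵥ (zipWith _+_ g h) ≡ +ᵥ g ⊕ +ᵥ h
+ᵥ-+ []      []      = refl
+ᵥ-+ (_ ∷ g) (_ ∷ h) = cong (_ ∷_) (+ᵥ-+ g h)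

+ᵥg≤+ᵥ[g+h] : (g h : Vec ℕ n) → +ᵥ g ≤ᵥ +ᵥ zipWith _+_ g h
+ᵥg≤+ᵥ[g+h] []      []      = []
+ᵥg≤+ᵥ[g+h] (k ∷ g) (l ∷ h) = +≤+ (ℕP.m≤m+n k l) ∷ +ᵥg≤+ᵥ[g+h] g h

+-cancelˡ-≡ᵥ : (g : Vec ℕ n) {h h′ : Vec ℕ n} → zipWith _+_ g h ≡ zipWith _+_ g h′ → h ≡ h′
+-cancelˡ-≡ᵥ []      {[]}    {[]}    _  = refl
+-cancelˡ-≡ᵥ (k ∷ g) {_ ∷ _} {_ ∷ _} eq =
  cong₂ _∷_ (ℕP.+-cancelˡ-≡ k _ _ (VecP.∷-injectiveˡ eq)) (+-cancelˡ-≡ᵥ g (VecP.∷-injectiveʳ eq))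

≤ᵥ⇒∃+ᵥ : {a c : Vec ℤ n} → a ≤ᵥ c → Σ (Vec ℕ n) λ g → c ≡ a ⊕ +ᵥ g
≤ᵥ⇒∃+ᵥ {a = a} {c} a≤c = ∣ c ⊖ a ∣ᵥ , (begin
  c                 ≡⟨ t⊕[x⊖t]≡x c a ⟨
  a ⊕ (c ⊖ a)       ≡⟨ cong (a ⊕_) (+ᵥ∣x∣ᵥ≡x 0≤c⊖a) ⟨
  a ⊕ +ᵥ ∣ c ⊖ a ∣ᵥ ∎)
  where
  open ≡-Reasoning
  0≤c⊖a : 0ᵥ ≤ᵥ c ⊖ a
  0≤c⊖a = subst (_≤ᵥ c ⊖ a) (x⊖x≡0ᵥ a) (⊕-monoˡ-≤ᵥ (Vec.map ℤ.-_ a) a≤c)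

InBox⇔Within : {lo hi c : Vec ℤ n} → InBox lo hi c ⇔ Within lo hi c
InBox⇔Within = mk⇔
  (λ c∈ → Extensional.extensional⇒inductive (Extensional.ext (proj₁ ∘ c∈)) ,
          Extensional.extensional⇒inductive (Extensional.ext (proj₂ ∘ c∈)))
  (λ (p , q) i → Pointwise.lookup p i , Pointwise.lookup q i)

∼-rooted : {P Q : CellSet n} → 0ᵥ ∈ P → 0ᵥ ∈ Q →
  (∀ {c} → c ∈ P → 0ᵥ ≤ᵥ c) → (∀ {c} → c ∈ Q → 0ᵥ ≤ᵥ c) → P ∼ Q → ∀ c → c ∈ P ⇔ c ∈ Q
∼-rooted {Q = Q} 0∈P 0∈Q P≥0 Q≥0 (t , P⇔Q) c =
  subst (λ c′ → _ ⇔ c′ ∈ Q) (trans (cong (c ⊕_) t≡0) (t⊕0ᵥ≡t c)) (P⇔Q c)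
  where
  t≡0 : t ≡ 0ᵥ
  t≡0 = 0≤t∧0≤-t⇒t≡0
    (subst (0ᵥ ≤ᵥ_) (0ᵥ⊕t≡t t) (Q≥0 (Equivalence.to (P⇔Q 0ᵥ) 0∈P)))
    (P≥0 (Equivalence.from (P⇔Q (0ᵥ ⊖ t)) (subst (_∈ Q) (sym (x⊖t⊕t≡x 0ᵥ t)) 0∈Q)))

cuboid-lookup-onto : (e : Vec ℕ n) (l : Fin n) {z : ℤ} → 0ℤ ℤ.≤ z → z ℤ.≤ + Vec.lookup e l →
  Σ (Vec ℤ n) λ y → Within 0ᵥ (+ᵥ e) y × Vec.lookup y l ≡ z
cuboid-lookup-onto (_ ∷ e) zero    {z} 0≤z z≤e = z ∷ 0ᵥ , (0≤z ∷ ≤ᵥ-refl , z≤e ∷ 0ᵥ≤+ᵥ e) , refl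
cuboid-lookup-onto (_ ∷ e) (suc l) 0≤z z≤e with cuboid-lookup-onto e l 0≤z z≤e
... | y , (0≤y , y≤e) , y[l]≡z = 0ℤ ∷ y , (ℤP.≤-refl ∷ 0≤y , +≤+ z≤n ∷ y≤e) , y[l]≡z

∑ : (Fin n → ℕ) → ℕ
∑ f = sum (List.tabulate f)

∑-+ : (f g : Fin n → ℕ) → ∑ (λ i → f i + g i) ≡ ∑ f + ∑ g
∑-+ {zero}  f g = refl
∑-+ {suc n} f g = begin
  (f zero + g zero) + ∑ (λ i → f (suc i) + g (suc i))
    ≡⟨ cong ((f zero + g zero) ℕ.+_) (∑-+ (f ∘ suc) (g ∘ suc)) ⟩
  (f zero + g zero) + (∑ (f ∘ suc) + ∑ (g ∘ suc))
    ≡⟨ interchange (f zero) (g zero) (∑ (f ∘ suc)) (∑ (g ∘ suc)) ⟩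
  (f zero + ∑ (f ∘ suc)) + (g zero + ∑ (g ∘ suc)) ∎
  where open ≡-Reasoning

∑-lookup : (v : Vec ℕ n) → ∑ (Vec.lookup v) ≡ Vec.sum v
∑-lookup []      = refl
∑-lookup (k ∷ v) = cong (k ℕ.+_) (∑-lookup v)

∑-1 : ∀ n → ∑ {n} (λ _ → 1) ≡ n
∑-1 zero    = refl
∑-1 (suc n) = cong suc (∑-1 n)

interval : ℕ → List ℤ
interval e = applyUpTo (λ k → + k) (suc e)

∈-interval⁺ : ∀ {e z} → 0ℤ ℤ.≤ z → z ℤ.≤ + e → z ∈ interval e
∈-interval⁺ {z = + k} _ (+≤+ k≤e) = ∈-applyUpTo⁺ (λ k → + k) (s≤s k≤e)

∈-interval⁻ : ∀ {e z} → z ∈ interval e → 0ℤ ℤ.≤ z × z ℤ.≤ + e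
∈-interval⁻ z∈ with ∈-applyUpTo⁻ (λ k → + k) z∈
... | _ , s≤s k≤e , refl = +≤+ z≤n , +≤+ k≤e

interval-unique : ∀ e → Unique (interval e)
interval-unique e = Unique.applyUpTo⁺₁ (λ k → + k) (suc e) (λ i<j _ → ℕP.<⇒≢ i<j ∘ ℤP.+-injective)

length-interval : ∀ e → length (interval e) ≡ suc e
length-interval e = length-applyUpTo (λ k → + k) (suc e)

cuboid : ∀ {n} → Vec ℕ n → List (Vec ℤ n)
cuboid []       = [] ∷ []
cuboid (e ∷ es) = cartesianProductWith _∷_ (interval e) (cuboid es)

∈-cuboid⁺ : ∀ {n} (e : Vec ℕ n) {y} → Within 0ᵥ (+ᵥ e) y → y ∈ cuboid e
∈-cuboid⁺ []       ([]     , [])     = here refl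
∈-cuboid⁺ (e ∷ es) (p ∷ ps , q ∷ qs) =
  ∈-cartesianProductWith⁺ _∷_ (∈-interval⁺ p q) (∈-cuboid⁺ es (ps , qs))

∈-cuboid⁻ : ∀ {n} (e : Vec ℕ n) {y} → y ∈ cuboid e → Within 0ᵥ (+ᵥ e) y
∈-cuboid⁻ []       {[]} _ = [] , []
∈-cuboid⁻ (e ∷ es) y∈ with ∈-cartesianProductWith⁻ _∷_ (interval e) (cuboid es) y∈
... | _ , _ , z∈ , y′∈ , refl with ∈-interval⁻ z∈ | ∈-cuboid⁻ es y′∈
...   | p , q | ps , qs = p ∷ ps , q ∷ qs

Path-trans : ∀ {P : CellSet n} {a b c} → Path P a b → Path P b c → Path P a c
Path-trans here         q = q
Path-trans (step s m p) q = step s m (Path-trans p q)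

ElemStep⇒≤ᵥ : ∀ {a b : Cell n} → ElemStep a b → a ≤ᵥ b
ElemStep⇒≤ᵥ {a = x ∷ a} (zero  , refl) = ℤP.i≤i+j x 1ℤ ∷ ≤ᵥ-refl
ElemStep⇒≤ᵥ {a = x ∷ a} (suc i , refl) = ℤP.≤-refl ∷ ElemStep⇒≤ᵥ (i , refl)

Path⇒≤ᵥ : ∀ {P : CellSet n} {a c} → Path P a c → a ≤ᵥ c
Path⇒≤ᵥ here         = ≤ᵥ-refl
Path⇒≤ᵥ (step s _ p) = ≤ᵥ-trans (ElemStep⇒≤ᵥ s) (Path⇒≤ᵥ p)

zero-or-updateAt-suc : (g : Vec ℕ n) →
  g ≡ replicate n 0 ⊎ Σ (Fin n) λ i → Σ (Vec ℕ n) λ g′ → g ≡ updateAt g′ i suc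
zero-or-updateAt-suc []      = inj₁ refl
zero-or-updateAt-suc (suc k ∷ g) = inj₂ (zero , k ∷ g , refl)
zero-or-updateAt-suc (zero ∷ g) with zero-or-updateAt-suc g
... | inj₁ eq             = inj₁ (cong (0 ∷_) eq)
... | inj₂ (i , g′ , eq) = inj₂ (suc i , 0 ∷ g′ , cong (0 ∷_) eq)

sum-updateAt-suc : (g : Vec ℕ n) (i : Fin n) → Vec.sum (updateAt g i suc) ≡ suc (Vec.sum g)
sum-updateAt-suc (k ∷ g) zero    = refl
sum-updateAt-suc (k ∷ g) (suc i) = trans (cong (k ℕ.+_) (sum-updateAt-suc g i)) (ℕP.+-suc k (Vec.sum g))

⊕+ᵥ-updateAt-suc : (a : Vec ℤ n) (g : Vec ℕ n) (i : Fin n) →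
  a ⊕ +ᵥ updateAt g i suc ≡ updateAt a i (ℤ._+ 1ℤ) ⊕ +ᵥ g
⊕+ᵥ-updateAt-suc (x ∷ a) (k ∷ g) zero    = cong (_∷ a ⊕ +ᵥ g) (i+[1+j]≡i+1+j x (+ k))
⊕+ᵥ-updateAt-suc (x ∷ a) (k ∷ g) (suc i) = cong (x ℤ.+ + k ∷_) (⊕+ᵥ-updateAt-suc a g i)

x⊕+ᵥ0≡x : (a : Vec ℤ n) → a ⊕ +ᵥ replicate n 0 ≡ a
x⊕+ᵥ0≡x []      = refl
x⊕+ᵥ0≡x (x ∷ a) = cong₂ _∷_ (ℤP.+-identityʳ x) (x⊕+ᵥ0≡x a)

-- Induction on the total length Σ g of the path: one step along a coordinate where g is positive.
boxPath′ : (P : CellSet n) (N : ℕ) (a : Cell n) (g : Vec ℕ n) → Vec.sum g ≡ N →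
  (∀ z → Within a (a ⊕ +ᵥ g) z → z ∈ P) → Path P a (a ⊕ +ᵥ g)
boxPath′ P N a g Σg≡N box⊆P with zero-or-updateAt-suc g
... | inj₁ refl = subst (Path P a) (sym (x⊕+ᵥ0≡x a)) here
boxPath′ P zero    a g Σg≡N box⊆P | inj₂ (i , g′ , refl)
  with () ← trans (sym (sum-updateAt-suc g′ i)) Σg≡N
boxPath′ P (suc N) a g Σg≡N box⊆P | inj₂ (i , g′ , refl) =
  subst (Path P a) (sym c≡) (step (i , refl) (box⊆P a′ (a≤a′ , a′≤c)) (boxPath′ P N a′ g′ Σg′≡N box′⊆P))
  where
  a′ = updateAt a i (ℤ._+ 1ℤ)
  c≡ = ⊕+ᵥ-updateAt-suc a g′ i
  a≤a′ : a ≤ᵥ a′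
  a≤a′ = ElemStep⇒≤ᵥ (i , refl)
  a′≤c : a′ ≤ᵥ a ⊕ +ᵥ updateAt g′ i suc
  a′≤c = subst (a′ ≤ᵥ_) (sym c≡) (x≤x⊕+ᵥg a′ g′)
  Σg′≡N : Vec.sum g′ ≡ N
  Σg′≡N = ℕP.suc-injective (trans (sym (sum-updateAt-suc g′ i)) Σg≡N)
  box′⊆P : ∀ z → Within a′ (a′ ⊕ +ᵥ g′) z → z ∈ P
  box′⊆P z (p , q) = box⊆P z (≤ᵥ-trans a≤a′ p , subst (z ≤ᵥ_) (sym c≡) q)

boxPath : (P : CellSet n) {a c : Cell n} → a ≤ᵥ c → (∀ z → Within a c z → z ∈ P) → Path P a c
boxPath P {a} a≤c box⊆P with ≤ᵥ⇒∃+ᵥ a≤c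
... | g , refl = boxPath′ P _ a g refl box⊆P

≤⇒≡⊎< : ∀ {x y : ℤ} → x ℤ.≤ y → x ≡ y ⊎ x ℤ.< y
≤⇒≡⊎< {x} {y} x≤y with x ℤ.≟ y
... | yes x≡y = inj₁ x≡y
... | no  x≢y = inj₂ (ℤP.≤∧≢⇒< x≤y x≢y)

ElemStep-first : ∀ {s b : Cell (suc n)} → ElemStep s b → first b ℤ.≤ ℤ.suc (first s)
ElemStep-first {s = x ∷ _} (zero  , refl) = ℤP.≤-reflexive (ℤP.+-comm x 1ℤ)
ElemStep-first {s = x ∷ _} (suc _ , refl) = ℤP.i≤j+i x 1ℤ

module _ {P : CellSet (suc n)} where

  Path-intermediate : ∀ {s c} → s ∈ P → Path P s c → ∀ z → first s ℤ.≤ z → z ℤ.≤ first c →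
    Σ (Cell (suc n)) λ b → b ∈ P × first b ≡ z
  Path-intermediate {s} s∈ here z s≤z z≤c = s , s∈ , ℤP.≤-antisym s≤z z≤c
  Path-intermediate {s} s∈ (step st b∈ p) z s≤z z≤c with ≤⇒≡⊎< s≤z
  ... | inj₁ s≡z = s , s∈ , s≡z
  ... | inj₂ s<z = Path-intermediate b∈ p z (ℤP.≤-trans (ElemStep-first st) (ℤP.i<j⇒suc[i]≤j s<z)) z≤c

  -- The first cell of the path on the level of c is ≤ c, hence equal to c since c is least there;
  -- the step into it raises the level, so it goes along the first axis.
  Path-enters-from-below : ∀ {s c} → s ∈ P → Path P s c → first s ℤ.< first c →
    (∀ z → z ∈ P → first z ≡ first c → c ≤ᵥ z) →
    Σ (Cell (suc n)) λ p → p ∈ P × c ≡ updateAt p zero (ℤ._+ 1ℤ)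
  Path-enters-from-below s∈ here s<c _ = ⊥-elim (ℤP.<-irrefl refl s<c)
  Path-enters-from-below {s@(_ ∷ _)} s∈ (step {b = b} st b∈ p) s<c c-least with ≤⇒≡⊎< (≤ᵥ-first (Path⇒≤ᵥ p))
  ... | inj₂ b<c = Path-enters-from-below b∈ p b<c c-least
  ... | inj₁ b≡c with ≤ᵥ-antisym (Path⇒≤ᵥ p) (c-least b b∈ b≡c) | st
  ...   | refl | zero  , b≡ = s , s∈ , b≡
  ...   | refl | suc _ , refl = ⊥-elim (ℤP.<-irrefl refl s<c)

module _ {B : Set} (_≟_ : DecidableEquality B) (f : Cell n → B) (h : Vec ℤ n → B → B)
         (h-injective : ∀ t {x y} → h t x ≡ h t y → x ≡ y)
         (f-⊕ : ∀ c t → f (c ⊕ t) ≡ h t (f c)) where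

  length-deduplicate-∼ : {P Q : CellSet n} → P ∼ Q →
    length (deduplicate _≟_ (map f Q)) ≡ length (deduplicate _≟_ (map f P))
  length-deduplicate-∼ {P} {Q} (t , P⇔Q) = trans
    (length-deduplicate _≟_ (map f Q) image
      (Unique.map⁺ (h-injective t) (deduplicate-! _≟_ (map f P))) Q⊆image image⊆Q)
    (length-map (h t) (deduplicate _≟_ (map f P)))
    where
    image = map (h t) (deduplicate _≟_ (map f P))
    Q⊆image : ∀ {b} → b ∈ map f Q → b ∈ image
    Q⊆image b∈ with ∈-map⁻ f b∈
    ... | c , c∈ , refl = subst (_∈ image) (trans (sym (f-⊕ (c ⊖ t) t)) (cong f (x⊖t⊕t≡x c t)))
      (∈-map⁺ (h t) (∈-deduplicate⁺ _≟_ (∈-map⁺ f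
        (Equivalence.from (P⇔Q (c ⊖ t)) (subst (_∈ Q) (sym (x⊖t⊕t≡x c t)) c∈)))))
    image⊆Q : ∀ {b} → b ∈ image → b ∈ map f Q
    image⊆Q b∈ with ∈-map⁻ (h t) b∈
    ... | _ , b′∈ , refl with ∈-map⁻ f (∈-deduplicate⁻ _≟_ (map f P) b′∈)
    ...   | c , c∈ , refl = subst (_∈ map f Q) (f-⊕ c t) (∈-map⁺ f (Equivalence.to (P⇔Q c) c∈))

first-⊕ : ∀ (c t : Cell n) → first (c ⊕ t) ≡ first c ℤ.+ first t
first-⊕ []      []      = refl
first-⊕ (_ ∷ _) (_ ∷ _) = refl

width-∼ : {P Q : CellSet n} → P ∼ Q → width Q ≡ width P
width-∼ = length-deduplicate-∼ ℤ._≟_ first (λ t x → x ℤ.+ first t) (λ t → +-cancelʳ-≡ᵢ (first t)) first-⊕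

projArea-∼ : {P Q : CellSet n} → P ∼ Q → ∀ l → projArea Q l ≡ projArea P l
projArea-∼ P∼Q l = length-deduplicate-∼ (×P.≡-dec ℤ._≟_ ℤ._≟_) (λ c → first c , Vec.lookup c l)
  (λ t (x , z) → x ℤ.+ first t , z ℤ.+ Vec.lookup t l)
  (λ t eq → ×P.×-≡,≡→≡ (+-cancelʳ-≡ᵢ _ (cong proj₁ eq) , +-cancelʳ-≡ᵢ _ (cong proj₂ eq)))
  (λ c t → cong₂ _,_ (first-⊕ c t) (VecP.lookup-zipWith ℤ._+_ l c t))
  P∼Q

lateralArea-∼ : {P Q : CellSet n} → P ∼ Q → lateralArea Q ≡ lateralArea P
lateralArea-∼ {n} P∼Q = cong sum (map-cong (projArea-∼ P∼Q) (List.drop 1 (List.allFin n)))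

module Stacks (D : ℕ) where

  infixl 6 _⊞_

  _⊞_ : Vec ℕ D → Vec ℕ D → Vec ℕ D
  _⊞_ = zipWith _+_

  up : Vec ℕ D → Cell (suc D)
  up o = 1ℤ ∷ +ᵥ o

  data Code : ℕ → Set where
    box   : (e : Vec ℕ D) → Code zero
    layer : ∀ {j} (o r : Vec ℕ D) → Code j → Code (suc j)

  Base : Vec ℕ D → Cell (suc D) → Set
  Base e (x ∷ y) = x ≡ 0ℤ × Within 0ᵥ (+ᵥ e) y

  -- layer o r w is the box [0, o + r] at level 0 with w translated by (1, o) on top of it.
  ⟦_⟧ : ∀ {j} → Code j → Cell (suc D) → Set
  ⟦ box e ⟧       c = Base e c
  ⟦ layer o r w ⟧ c = Base (o ⊞ r) c ⊎ Σ (Cell (suc D)) λ c′ → ⟦ w ⟧ c′ × c ≡ c′ ⊕ up o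

  baseCells : Vec ℕ D → CellSet (suc D)
  baseCells e = map (0ℤ ∷_) (cuboid e)

  cells : ∀ {j} → Code j → CellSet (suc D)
  cells (box e)       = baseCells e
  cells (layer o r w) = baseCells (o ⊞ r) ++ map (_⊕ up o) (cells w)

  ∈-baseCells⁺ : ∀ e {c} → Base e c → c ∈ baseCells e
  ∈-baseCells⁺ e {_ ∷ _} (refl , y∈) = ∈-map⁺ (0ℤ ∷_) (∈-cuboid⁺ e y∈)

  ∈-baseCells⁻ : ∀ e {c} → c ∈ baseCells e → Base e c
  ∈-baseCells⁻ e c∈ with ∈-map⁻ (0ℤ ∷_) c∈
  ... | _ , y∈ , refl = refl , ∈-cuboid⁻ e y∈

  ∈-cells⁺ : ∀ {j} (w : Code j) {c} → ⟦ w ⟧ c → c ∈ cells w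
  ∈-cells⁺ (box e)       c∈ = ∈-baseCells⁺ e c∈
  ∈-cells⁺ (layer o r w) (inj₁ c∈) = ∈-++⁺ˡ (∈-baseCells⁺ (o ⊞ r) c∈)
  ∈-cells⁺ (layer o r w) (inj₂ (c′ , c′∈ , refl)) =
    ∈-++⁺ʳ (baseCells (o ⊞ r)) (∈-map⁺ (_⊕ up o) (∈-cells⁺ w c′∈))

  ∈-cells⁻ : ∀ {j} (w : Code j) {c} → c ∈ cells w → ⟦ w ⟧ c
  ∈-cells⁻ (box e)       c∈ = ∈-baseCells⁻ e c∈
  ∈-cells⁻ (layer o r w) c∈ with ∈-++⁻ (baseCells (o ⊞ r)) c∈
  ... | inj₁ c∈ˡ = inj₁ (∈-baseCells⁻ (o ⊞ r) c∈ˡ)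
  ... | inj₂ c∈ʳ with ∈-map⁻ (_⊕ up o) c∈ʳ
  ...   | c′ , c′∈ , refl = inj₂ (c′ , ∈-cells⁻ w c′∈ , refl)

  record Stack (j : ℕ) (S : Cell (suc D) → Set) : Set where
    field
      lower upper : ∀ {a} → a ≤ j → Vec ℤ D
      bounded     : ∀ {c} → S c → 0ℤ ℤ.≤ first c × first c ℤ.≤ + j
      stratum     : ∀ {a} (a≤j : a ≤ j) y → S (+ a ∷ y) ⇔ Within (lower a≤j) (upper a≤j) y
      nonempty    : ∀ {a} (a≤j : a ≤ j) → lower a≤j ≤ᵥ upper a≤j
      lower-0     : lower z≤n ≡ 0ᵥ
      supported   : ∀ {a} (a<j : a < j) → S (+ a ∷ lower a<j)

    base : ∀ y → S (0ℤ ∷ y) ⇔ Within 0ᵥ (upper z≤n) y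
    base y = subst (λ l → S (0ℤ ∷ y) ⇔ Within l (upper z≤n) y) lower-0 (stratum z≤n y)

    0≤upper₀ : 0ᵥ ≤ᵥ upper z≤n
    0≤upper₀ = subst (_≤ᵥ upper z≤n) lower-0 (nonempty z≤n)

  lowerᶜ upperᶜ : ∀ {j} → Code j → ∀ {a} → a ≤ j → Vec ℤ D
  lowerᶜ (box e)       _         = 0ᵥ
  lowerᶜ (layer o r w) z≤n       = 0ᵥ
  lowerᶜ (layer o r w) (s≤s a≤j) = lowerᶜ w a≤j ⊕ +ᵥ o
  upperᶜ (box e)       _         = +ᵥ e
  upperᶜ (layer o r w) z≤n       = +ᵥ (o ⊞ r)
  upperᶜ (layer o r w) (s≤s a≤j) = upperᶜ w a≤j ⊕ +ᵥ o

  lowerᶜ-0 : ∀ {j} (w : Code j) → lowerᶜ w z≤n ≡ 0ᵥ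
  lowerᶜ-0 (box e)       = refl
  lowerᶜ-0 (layer o r w) = refl

  lowerᶜ-1 : ∀ {j} (o r : Vec ℕ D) (w : Code j) → lowerᶜ (layer o r w) (s≤s z≤n) ≡ +ᵥ o
  lowerᶜ-1 o r w = trans (cong (_⊕ +ᵥ o) (lowerᶜ-0 w)) (0ᵥ⊕t≡t (+ᵥ o))

  ⟦⟧-bounded : ∀ {j} (w : Code j) {c} → ⟦ w ⟧ c → 0ℤ ℤ.≤ first c × first c ℤ.≤ + j
  ⟦⟧-bounded (box e)       {_ ∷ _} (refl , _)        = ℤP.≤-refl , ℤP.≤-refl
  ⟦⟧-bounded (layer o r w) {_ ∷ _} (inj₁ (refl , _)) = ℤP.≤-refl , +≤+ z≤n
  ⟦⟧-bounded (layer {j} o r w) (inj₂ (x ∷ y , c∈ , refl)) with ⟦⟧-bounded w c∈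
  ... | 0≤x , x≤j = ℤP.≤-trans 0≤x (ℤP.i≤i+j x 1ℤ) ,
                    subst (x ℤ.+ 1ℤ ℤ.≤_) (sym (+[1+a]≡+a+1 j)) (ℤP.+-monoˡ-≤ 1ℤ x≤j)

  ⟦⟧-nonempty : ∀ {j} (w : Code j) {a} (a≤j : a ≤ j) → lowerᶜ w a≤j ≤ᵥ upperᶜ w a≤j
  ⟦⟧-nonempty (box e)       _         = 0ᵥ≤+ᵥ e
  ⟦⟧-nonempty (layer o r w) z≤n       = 0ᵥ≤+ᵥ (o ⊞ r)
  ⟦⟧-nonempty (layer o r w) (s≤s a≤j) = ⊕-monoˡ-≤ᵥ (+ᵥ o) (⟦⟧-nonempty w a≤j)

  ⟦⟧-supported : ∀ {j} (w : Code j) {a} (a<j : a < j) → ⟦ w ⟧ (+ a ∷ lowerᶜ w a<j)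
  ⟦⟧-supported (layer o r w) (s≤s z≤n) =
    inj₁ (refl , subst (Within 0ᵥ (+ᵥ (o ⊞ r))) (sym (lowerᶜ-1 o r w)) (0ᵥ≤+ᵥ o , +ᵥg≤+ᵥ[g+h] o r))
  ⟦⟧-supported (layer o r w) {suc a} (s≤s a<j) =
    inj₂ (+ a ∷ lowerᶜ w a<j , ⟦⟧-supported w a<j , cong (_∷ lowerᶜ w a<j ⊕ +ᵥ o) (+[1+a]≡+a+1 a))

  ⟦⟧-stratum : ∀ {j} (w : Code j) {a} (a≤j : a ≤ j) y →
    ⟦ w ⟧ (+ a ∷ y) ⇔ Within (lowerᶜ w a≤j) (upperᶜ w a≤j) y
  ⟦⟧-stratum (box e)       z≤n y = mk⇔ proj₂ (refl ,_)
  ⟦⟧-stratum (layer o r w) z≤n y = mk⇔ to (λ y∈ → inj₁ (refl , y∈))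
    where
    to : ⟦ layer o r w ⟧ (+ 0 ∷ y) → Within 0ᵥ (+ᵥ (o ⊞ r)) y
    to (inj₁ (_ , y∈))          = y∈
    to (inj₂ (_ ∷ _ , c∈ , eq)) =
      ⊥-elim (i+1≢0 (proj₁ (⟦⟧-bounded w c∈)) (sym (VecP.∷-injectiveˡ eq)))
  ⟦⟧-stratum (layer o r w) {suc a} (s≤s a≤j) y = mk⇔ to from
    where
    module IH = Equivalence (⟦⟧-stratum w a≤j (y ⊖ +ᵥ o))
    y≡ : y ⊖ +ᵥ o ⊕ +ᵥ o ≡ y
    y≡ = x⊖t⊕t≡x y (+ᵥ o)
    to : ⟦ layer o r w ⟧ (+ suc a ∷ y) → Within (lowerᶜ w a≤j ⊕ +ᵥ o) (upperᶜ w a≤j ⊕ +ᵥ o) y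
    to (inj₂ (x ∷ y′ , c∈ , eq)) = subst (Within _ _) y≡ (Within-⊕ (+ᵥ o) (IH.to c∈′))
      where
      x≡a : x ≡ + a
      x≡a = +-cancelʳ-≡ᵢ 1ℤ (trans (sym (VecP.∷-injectiveˡ eq)) (+[1+a]≡+a+1 a))
      y≡y′⊕o : y ≡ y′ ⊕ +ᵥ o
      y≡y′⊕o = VecP.∷-injectiveʳ eq
      c∈′ : ⟦ w ⟧ (+ a ∷ y ⊖ +ᵥ o)
      c∈′ = subst ⟦ w ⟧ (cong₂ _∷_ x≡a (sym (trans (cong (_⊖ +ᵥ o) y≡y′⊕o) (x⊕t⊖t≡x y′ (+ᵥ o))))) c∈
    from : Within (lowerᶜ w a≤j ⊕ +ᵥ o) (upperᶜ w a≤j ⊕ +ᵥ o) y → ⟦ layer o r w ⟧ (+ suc a ∷ y)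
    from y∈ = inj₂ (+ a ∷ y ⊖ +ᵥ o , IH.from (Within-⊕⁻ (+ᵥ o) (subst (Within _ _) (sym y≡) y∈)) ,
                    cong₂ _∷_ (+[1+a]≡+a+1 a) (sym y≡))

  ⟦⟧-stack : ∀ {j} (w : Code j) → Stack j ⟦ w ⟧
  ⟦⟧-stack w = record
    { lower     = lowerᶜ w
    ; upper     = upperᶜ w
    ; bounded   = ⟦⟧-bounded w
    ; stratum   = ⟦⟧-stratum w
    ; nonempty  = ⟦⟧-nonempty w
    ; lower-0   = lowerᶜ-0 w
    ; supported = ⟦⟧-supported w
    }

  Stack-cong : ∀ {j} {S T : Cell (suc D) → Set} → (∀ c → S c ⇔ T c) → Stack j S → Stack j T
  Stack-cong S⇔T st = record
    { lower     = lower
    ; upper     = upper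
    ; bounded   = bounded ∘ Equivalence.from (S⇔T _)
    ; stratum   = λ a≤j y → stratum a≤j y ⇔-∘ ⇔-sym (S⇔T _)
    ; nonempty  = nonempty
    ; lower-0   = lower-0
    ; supported = Equivalence.to (S⇔T _) ∘ supported
    }
    where open Stack st

  module _ {j} {P : CellSet (suc D)} (st : Stack j (_∈ P)) where
    open Stack st

    private
      ∈P⇒Within : ∀ {a} (a≤j : a ≤ j) {y} → (+ a ∷ y) ∈ P → Within (lower a≤j) (upper a≤j) y
      ∈P⇒Within a≤j = Equivalence.to (stratum a≤j _)

      Within⇒∈P : ∀ {a} (a≤j : a ≤ j) {y} → Within (lower a≤j) (upper a≤j) y → (+ a ∷ y) ∈ P
      Within⇒∈P a≤j = Equivalence.from (stratum a≤j _)

      lower∈P : ∀ {a} (a≤j : a ≤ j) → (+ a ∷ lower a≤j) ∈ P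
      lower∈P a≤j = Within⇒∈P a≤j (≤ᵥ-refl , nonempty a≤j)

    stratumPath : ∀ {a} (a≤j : a ≤ j) {y y′} → (+ a ∷ y) ∈ P → (+ a ∷ y′) ∈ P → y ≤ᵥ y′ →
      Path P (+ a ∷ y) (+ a ∷ y′)
    stratumPath {a} a≤j y∈ y′∈ y≤y′ = boxPath P (ℤP.≤-refl ∷ y≤y′) between∈P
      where
      between∈P : ∀ z → Within (+ a ∷ _) (+ a ∷ _) z → z ∈ P
      between∈P (x ∷ z) (a≤x ∷ y≤z , x≤a ∷ z≤y′) rewrite ℤP.≤-antisym x≤a a≤x =
        Within⇒∈P a≤j (≤ᵥ-trans (proj₁ (∈P⇒Within a≤j y∈)) y≤z , ≤ᵥ-trans z≤y′ (proj₂ (∈P⇒Within a≤j y′∈)))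

    origin∈P : 0ᵥ ∈ P
    origin∈P = subst (λ l → (0ℤ ∷ l) ∈ P) lower-0 (lower∈P z≤n)

    -- Climb level by level, entering level a + 1 at its lower corner, which sits on level a.
    pathFromOrigin : ∀ {a} (a≤j : a ≤ j) {y} → (+ a ∷ y) ∈ P → Path P 0ᵥ (+ a ∷ y)
    pathFromOrigin {zero} z≤n y∈ =
      subst (λ l → Path P (0ℤ ∷ l) _) lower-0
        (stratumPath z≤n (lower∈P z≤n) y∈ (proj₁ (∈P⇒Within z≤n y∈)))
    pathFromOrigin {suc a} a<j y∈ =
      Path-trans (pathFromOrigin (ℕP.<⇒≤ a<j) (supported a<j))
        (step (zero , cong (_∷ lower a<j) (+[1+a]≡+a+1 a)) (lower∈P a<j)
          (stratumPath a<j (lower∈P a<j) y∈ (proj₁ (∈P⇒Within a<j y∈))))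

    reachable : ∀ c → c ∈ P → Path P 0ᵥ c
    reachable (x ∷ y) c∈ with bounded c∈
    ... | +≤+ _ , +≤+ a≤j = pathFromOrigin a≤j c∈

    Stack⇒Directed : Directed P
    Stack⇒Directed = 0ᵥ , origin∈P , reachable

    Stack⇒AllPlateaus : AllPlateaus P
    Stack⇒AllPlateaus x (c , c∈ , refl) with c | bounded c∈
    ... | _ ∷ _ | +≤+ _ , +≤+ {m = a} a≤j =
      (+ a ∷ lower a≤j) , (+ a ∷ upper a≤j) , λ where
        (_ ∷ y) refl → ⇔-sym InBox⇔Within ⇔-∘ (head-refl ⇔-∘ stratum a≤j y)
      where
      head-refl : ∀ {lo hi y} → Within lo hi y ⇔ Within (+ a ∷ lo) (+ a ∷ hi) (+ a ∷ y)
      head-refl = mk⇔ (λ (p , q) → ℤP.≤-refl ∷ p , ℤP.≤-refl ∷ q) (λ { (_ ∷ p , _ ∷ q) → p , q })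

    Stack⇒width : width P ≡ suc j
    Stack⇒width = trans
      (length-deduplicate ℤ._≟_ (map first P) (interval j) (interval-unique j) levels⊆ ⊆levels)
      (length-interval j)
      where
      levels⊆ : ∀ {x} → x ∈ map first P → x ∈ interval j
      levels⊆ x∈ with ∈-map⁻ first x∈
      ... | _ , c∈ , refl = uncurry ∈-interval⁺ (bounded c∈)
      ⊆levels : ∀ {x} → x ∈ interval j → x ∈ map first P
      ⊆levels x∈ with ∈-applyUpTo⁻ (λ k → + k) x∈
      ... | _ , s≤s a≤j , refl = ∈-map⁺ first (lower∈P a≤j)

  module _ {j} {S : Cell (suc D) → Set} (st : Stack (suc j) S) where
    open Stack st

    lower₁ : Vec ℤ D
    lower₁ = lower {1} (s≤s z≤n)

    Above : Cell (suc D) → Set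
    Above c = 0ℤ ℤ.≤ first c × S (c ⊕ (1ℤ ∷ lower₁))

    Above-shift : ∀ a y → (+ a ∷ y) ⊕ (1ℤ ∷ lower₁) ≡ (+ suc a ∷ y ⊕ lower₁)
    Above-shift a y = cong (_∷ y ⊕ lower₁) (sym (+[1+a]≡+a+1 a))

    Stack-above : Stack j Above
    Stack-above = record
      { lower     = λ a≤j → lower (s≤s a≤j) ⊖ lower₁
      ; upper     = λ a≤j → upper (s≤s a≤j) ⊖ lower₁
      ; bounded   = λ { {x ∷ _} (0≤x , c∈) →
                        0≤x , +-cancelʳ-≤ᵢ 1ℤ (subst (x ℤ.+ 1ℤ ℤ.≤_) (+[1+a]≡+a+1 j) (proj₂ (bounded c∈))) }
      ; stratum   = λ a≤j y → Within-⊕⇔ lower₁ ⇔-∘ (stratum (s≤s a≤j) (y ⊕ lower₁) ⇔-∘ level≥1 _ y)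
      ; nonempty  = λ a≤j → ⊕-monoˡ-≤ᵥ _ (nonempty (s≤s a≤j))
      ; lower-0   = x⊖x≡0ᵥ lower₁
      ; supported = λ {a} a<j → +≤+ z≤n ,
                      subst S (sym (trans (Above-shift a _) (cong (_ ∷_) (x⊖t⊕t≡x _ lower₁))))
                        (supported (s≤s a<j))
      }
      where
      level≥1 : ∀ a y → Above (+ a ∷ y) ⇔ S (+ suc a ∷ y ⊕ lower₁)
      level≥1 a y = mk⇔ (λ (_ , c∈) → subst S (Above-shift a y) c∈)
                            (λ c∈ → +≤+ z≤n , subst S (sym (Above-shift a y)) c∈)

  Stack⇒Code : ∀ {j} {S : Cell (suc D) → Set} → Stack j S → Σ (Code j) λ w → ∀ c → S c ⇔ ⟦ w ⟧ c
  Stack⇒Code {zero} {S} st = box ∣ upper z≤n ∣ᵥ , λ c → mk⇔ (to c) (from c)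
    where
    open Stack st
    e≡ : +ᵥ ∣ upper z≤n ∣ᵥ ≡ upper z≤n
    e≡ = +ᵥ∣x∣ᵥ≡x 0≤upper₀
    to : ∀ c → S c → Base ∣ upper z≤n ∣ᵥ c
    to (x ∷ y) c∈ with bounded c∈
    ... | 0≤x , x≤0 with refl ← ℤP.≤-antisym x≤0 0≤x =
      refl , subst (λ h → Within 0ᵥ h y) (sym e≡) (Equivalence.to (base y) c∈)
    from : ∀ c → Base ∣ upper z≤n ∣ᵥ c → S c
    from (_ ∷ y) (refl , y∈) = Equivalence.from (base y) (subst (λ h → Within 0ᵥ h y) e≡ y∈)
  Stack⇒Code {suc j} {S} st with Stack⇒Code (Stack-above st)
  ... | w , above⇔ = layer o r w , λ c → mk⇔ (to c) (from c)
    where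
    open Stack st
    ℓ = lower₁ st
    o r : Vec ℕ D
    o = ∣ ℓ ∣ᵥ
    r = ∣ upper z≤n ⊖ ℓ ∣ᵥ
    ℓ∈ : Within 0ᵥ (upper z≤n) ℓ
    ℓ∈ = Equivalence.to (base ℓ) (supported (s≤s z≤n))
    o≡ : +ᵥ o ≡ ℓ
    o≡ = +ᵥ∣x∣ᵥ≡x (proj₁ ℓ∈)
    o⊞r≡ : +ᵥ (o ⊞ r) ≡ upper z≤n
    o⊞r≡ = begin
      +ᵥ (o ⊞ r)             ≡⟨ +ᵥ-+ o r ⟩
      +ᵥ o ⊕ +ᵥ r            ≡⟨ cong₂ _⊕_ o≡ (+ᵥ∣x∣ᵥ≡x 0≤upper₀⊖ℓ) ⟩
      ℓ ⊕ (upper z≤n ⊖ ℓ)    ≡⟨ t⊕[x⊖t]≡x (upper z≤n) ℓ ⟩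
      upper z≤n              ∎
      where
      open ≡-Reasoning
      0≤upper₀⊖ℓ : 0ᵥ ≤ᵥ upper z≤n ⊖ ℓ
      0≤upper₀⊖ℓ = subst (_≤ᵥ upper z≤n ⊖ ℓ) (x⊖x≡0ᵥ ℓ) (⊕-monoˡ-≤ᵥ _ (proj₂ ℓ∈))
    up≡ : up o ≡ 1ℤ ∷ ℓ
    up≡ = cong (1ℤ ∷_) o≡
    to : ∀ c → S c → ⟦ layer o r w ⟧ c
    to (x ∷ y) c∈ with bounded c∈
    ... | +≤+ {n = zero} _ , _ =
      inj₁ (refl , subst (λ h → Within 0ᵥ h y) (sym o⊞r≡) (Equivalence.to (base y) c∈))
    ... | +≤+ {n = suc k} _ , _ =
      inj₂ (c′ , Equivalence.to (above⇔ c′) (+≤+ z≤n , subst S c≡ c∈) , trans c≡ (cong (c′ ⊕_) (sym up≡)))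
      where
      c′ = + k ∷ y ⊖ ℓ
      c≡ : (+ suc k ∷ y) ≡ c′ ⊕ (1ℤ ∷ ℓ)
      c≡ = sym (trans (Above-shift st k (y ⊖ ℓ)) (cong (_ ∷_) (x⊖t⊕t≡x y ℓ)))
    from : ∀ c → ⟦ layer o r w ⟧ c → S c
    from (_ ∷ y) (inj₁ (refl , y∈))      = Equivalence.from (base y) (subst (λ h → Within 0ᵥ h y) o⊞r≡ y∈)
    from c       (inj₂ (c′ , c′∈ , c≡)) =
      subst S (sym (trans c≡ (cong (c′ ⊕_) up≡))) (proj₂ (Equivalence.from (above⇔ c′) c′∈))

  ⟦⟧-corners : ∀ {j} (w w′ : Code j) → (∀ c → ⟦ w ⟧ c ⇔ ⟦ w′ ⟧ c) → ∀ {a} (a≤j : a ≤ j) →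
    lowerᶜ w a≤j ≡ lowerᶜ w′ a≤j × upperᶜ w a≤j ≡ upperᶜ w′ a≤j
  ⟦⟧-corners w w′ w⇔w′ {a} a≤j = Within-corners (⟦⟧-nonempty w a≤j)
    λ y → ⟦⟧-stratum w′ a≤j y ⇔-∘ (w⇔w′ (+ a ∷ y) ⇔-∘ ⇔-sym (⟦⟧-stratum w a≤j y))

  ⟦⟧-injective : ∀ {j} (w w′ : Code j) → (∀ c → ⟦ w ⟧ c ⇔ ⟦ w′ ⟧ c) → w ≡ w′
  ⟦⟧-injective (box e) (box e′) w⇔w′ = cong box (+ᵥ-injective (proj₂ (⟦⟧-corners _ _ w⇔w′ z≤n)))
  ⟦⟧-injective (layer o r w) (layer o′ r′ w′) w⇔w′
    with refl ← +ᵥ-injective (trans (sym (lowerᶜ-1 o r w))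
                  (trans (proj₁ (⟦⟧-corners (layer o r w) (layer o′ r′ w′) w⇔w′ (s≤s z≤n)))
                         (lowerᶜ-1 o′ r′ w′)))
    = cong₂ (layer o) r≡r′ (⟦⟧-injective w w′ λ c → mk⇔ (above w w′ w⇔w′) (above w′ w (⇔-sym ∘ w⇔w′)))
    where
    r≡r′ : r ≡ r′
    r≡r′ = +-cancelˡ-≡ᵥ o (+ᵥ-injective (proj₂ (⟦⟧-corners (layer o r w) (layer o r′ w′) w⇔w′ z≤n)))
    above : ∀ {r r′} (v v′ : Code _) → (∀ c → ⟦ layer o r v ⟧ c ⇔ ⟦ layer o r′ v′ ⟧ c) →
      ∀ {c} → ⟦ v ⟧ c → ⟦ v′ ⟧ c
    above v v′ v⇔v′ {c@(_ ∷ _)} c∈ with Equivalence.to (v⇔v′ (c ⊕ up o)) (inj₂ (c , c∈ , refl))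
    ... | inj₁ (x+1≡0 , _)     = ⊥-elim (i+1≢0 (proj₁ (⟦⟧-bounded v c∈)) x+1≡0)
    ... | inj₂ (c′ , c′∈ , eq) = subst ⟦ v′ ⟧ (sym (⊕-cancelʳ (up o) eq)) c′∈

  ∈-cells⇔ : ∀ {j} (w : Code j) c → ⟦ w ⟧ c ⇔ c ∈ cells w
  ∈-cells⇔ w c = mk⇔ (∈-cells⁺ w) (∈-cells⁻ w)

  cells-stack : ∀ {j} (w : Code j) → Stack j (_∈ cells w)
  cells-stack w = Stack-cong (∈-cells⇔ w) (⟦⟧-stack w)

  cells-injective : ∀ {j} (w w′ : Code j) → cells w ∼ cells w′ → w ≡ w′
  cells-injective w w′ w∼w′ = ⟦⟧-injective w w′ λ c →
    ⇔-sym (∈-cells⇔ w′ c) ⇔-∘ (∼-rooted (origin∈P (cells-stack w)) (origin∈P (cells-stack w′))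
                                 (nonneg w) (nonneg w′) w∼w′ c ⇔-∘ ∈-cells⇔ w c)
    where
    nonneg : ∀ v {c} → c ∈ cells v → 0ᵥ ≤ᵥ c
    nonneg v c∈ = Path⇒≤ᵥ (reachable (cells-stack v) _ c∈)

  π : Fin D → Cell (suc D) → ℤ × ℤ
  π l c = first c , Vec.lookup c (suc l)

  shiftπ : ℕ → ℤ × ℤ → ℤ × ℤ
  shiftπ s (x , z) = x ℤ.+ 1ℤ , z ℤ.+ + s

  shiftπ-injective : ∀ s {p q} → shiftπ s p ≡ shiftπ s q → p ≡ q
  shiftπ-injective s {_ , _} {_ , _} eq =
    cong₂ _,_ (+-cancelʳ-≡ᵢ 1ℤ (cong proj₁ eq)) (+-cancelʳ-≡ᵢ (+ s) (cong proj₂ eq))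

  baseProjection : Fin D → Vec ℕ D → List (ℤ × ℤ)
  baseProjection l e = map (0ℤ ,′_) (interval (Vec.lookup e l))

  projection : ∀ {j} → Fin D → Code j → List (ℤ × ℤ)
  projection l (box e)       = baseProjection l e
  projection l (layer o r w) = baseProjection l (o ⊞ r) ++ map (shiftπ (Vec.lookup o l)) (projection l w)

  π-up : ∀ l (c : Cell (suc D)) o → π l (c ⊕ up o) ≡ shiftπ (Vec.lookup o l) (π l c)
  π-up l (x ∷ y) o = cong (x ℤ.+ 1ℤ ,_)
    (trans (VecP.lookup-zipWith ℤ._+_ l y (+ᵥ o)) (cong (ℤ._+_ (Vec.lookup y l)) (VecP.lookup-map l (λ k → + k) o)))

  ∈-baseProjection⁺ : ∀ l e {c} → Base e c → π l c ∈ baseProjection l e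
  ∈-baseProjection⁺ l e {_ ∷ y} (refl , 0≤y , y≤e) = ∈-map⁺ (0ℤ ,′_) (∈-interval⁺
    (subst (ℤ._≤ Vec.lookup y l) (VecP.lookup-replicate l 0ℤ) (Pointwise.lookup 0≤y l))
    (subst (Vec.lookup y l ℤ.≤_) (VecP.lookup-map l (λ k → + k) e) (Pointwise.lookup y≤e l)))

  ∈-baseProjection⁻ : ∀ l e {p} → p ∈ baseProjection l e → Σ (Cell (suc D)) λ c → Base e c × π l c ≡ p
  ∈-baseProjection⁻ l e p∈ with ∈-map⁻ (0ℤ ,′_) p∈
  ... | z , z∈ , refl with cuboid-lookup-onto e l (proj₁ (∈-interval⁻ z∈)) (proj₂ (∈-interval⁻ z∈))
  ...   | y , y∈ , y[l]≡z = 0ℤ ∷ y , (refl , y∈) , cong (0ℤ ,′_) y[l]≡z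

  ∈-projection⁺ : ∀ {j} l (w : Code j) {c} → ⟦ w ⟧ c → π l c ∈ projection l w
  ∈-projection⁺ l (box e)       c∈        = ∈-baseProjection⁺ l e c∈
  ∈-projection⁺ l (layer o r w) (inj₁ c∈) = ∈-++⁺ˡ (∈-baseProjection⁺ l (o ⊞ r) c∈)
  ∈-projection⁺ l (layer o r w) (inj₂ (c′ , c′∈ , refl)) =
    ∈-++⁺ʳ (baseProjection l (o ⊞ r)) (subst (_∈ _) (sym (π-up l c′ o)) (∈-map⁺ _ (∈-projection⁺ l w c′∈)))

  ∈-projection⁻ : ∀ {j} l (w : Code j) {p} → p ∈ projection l w → Σ (Cell (suc D)) λ c → ⟦ w ⟧ c × π l c ≡ p
  ∈-projection⁻ l (box e)       p∈ = ∈-baseProjection⁻ l e p∈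
  ∈-projection⁻ l (layer o r w) p∈ with ∈-++⁻ (baseProjection l (o ⊞ r)) p∈
  ... | inj₁ p∈ˡ with ∈-baseProjection⁻ l (o ⊞ r) p∈ˡ
  ...   | c , c∈ , eq = c , inj₁ c∈ , eq
  ∈-projection⁻ l (layer o r w) p∈ | inj₂ p∈ʳ with ∈-map⁻ (shiftπ (Vec.lookup o l)) p∈ʳ
  ...   | p′ , p′∈ , refl with ∈-projection⁻ l w p′∈
  ...     | c′ , c′∈ , refl = c′ ⊕ up o , inj₂ (c′ , c′∈ , refl) , π-up l c′ o

  projection-unique : ∀ {j} l (w : Code j) → Unique (projection l w)
  projection-unique l (box e)       = Unique.map⁺ (cong proj₂) (interval-unique _)
  projection-unique l (layer o r w) = Unique.++⁺
    (Unique.map⁺ (cong proj₂) (interval-unique _))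
    (Unique.map⁺ (shiftπ-injective _) (projection-unique l w))
    disjoint
    where
    disjoint : ∀ {p} → p ∈ baseProjection l (o ⊞ r) × p ∈ map (shiftπ (Vec.lookup o l)) (projection l w) → ⊥
    disjoint (p∈ˡ , p∈ʳ) with ∈-map⁻ (0ℤ ,′_) p∈ˡ | ∈-map⁻ (shiftπ (Vec.lookup o l)) p∈ʳ
    ... | _ , _ , refl | _ , p′∈ , eq with ∈-projection⁻ l w p′∈
    ...   | _ ∷ _ , c′∈ , refl = i+1≢0 (proj₁ (⟦⟧-bounded w c′∈)) (sym (cong proj₁ eq))

  projArea-cells : ∀ {j} (w : Code j) l → projArea (cells w) (suc l) ≡ length (projection l w)
  projArea-cells w l = length-deduplicate (×P.≡-dec ℤ._≟_ ℤ._≟_) (map (π l) (cells w))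
    (projection l w) (projection-unique l w) ⊆projection projection⊆
    where
    ⊆projection : ∀ {p} → p ∈ map (π l) (cells w) → p ∈ projection l w
    ⊆projection p∈ with ∈-map⁻ (π l) p∈
    ... | c , c∈ , refl = ∈-projection⁺ l w (∈-cells⁻ w c∈)
    projection⊆ : ∀ {p} → p ∈ projection l w → p ∈ map (π l) (cells w)
    projection⊆ p∈ with ∈-projection⁻ l w p∈
    ... | c , c∈ , refl = ∈-map⁺ (π l) (∈-cells⁺ w c∈)

  size : ℕ → ℕ
  size zero    = D
  size (suc j) = D + (D + size j)

  toVec : ∀ {j} → Code j → Vec ℕ (size j)
  toVec (box e)       = e
  toVec (layer o r w) = o Vec.++ r Vec.++ toVec w

  fromVec : ∀ j → Vec ℕ (size j) → Code j
  fromVec zero    v = box v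
  fromVec (suc j) v = layer (Vec.take D v) (Vec.take D (Vec.drop D v)) (fromVec j (Vec.drop D (Vec.drop D v)))

  toVec-fromVec : ∀ j v → toVec (fromVec j v) ≡ v
  toVec-fromVec zero    v = refl
  toVec-fromVec (suc j) v = begin
    Vec.take D v Vec.++ Vec.take D (Vec.drop D v) Vec.++ toVec (fromVec j (Vec.drop D (Vec.drop D v)))
      ≡⟨ cong (λ u → Vec.take D v Vec.++ Vec.take D (Vec.drop D v) Vec.++ u) (toVec-fromVec j _) ⟩
    Vec.take D v Vec.++ Vec.take D (Vec.drop D v) Vec.++ Vec.drop D (Vec.drop D v)
      ≡⟨ cong (Vec.take D v Vec.++_) (VecP.take++drop≡id D (Vec.drop D v)) ⟩
    Vec.take D v Vec.++ Vec.drop D v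
      ≡⟨ VecP.take++drop≡id D v ⟩
    v ∎
    where open ≡-Reasoning

  toVec-injective : ∀ {j} (w w′ : Code j) → toVec w ≡ toVec w′ → w ≡ w′
  toVec-injective (box e)       (box e′)         eq = cong box eq
  toVec-injective (layer o r w) (layer o′ r′ w′) eq
    with refl ← VecP.++-injectiveˡ o o′ eq
    with refl ← VecP.++-injectiveˡ r r′ (VecP.++-injectiveʳ o o′ eq)
    = cong (layer o r) (toVec-injective w w′ (VecP.++-injectiveʳ r r′ (VecP.++-injectiveʳ o o′ eq)))

  fromVec-toVec : ∀ {j} (w : Code j) → fromVec j (toVec w) ≡ w
  fromVec-toVec {j} w = toVec-injective _ w (toVec-fromVec j (toVec w))

  length-baseProjection : ∀ l e → length (baseProjection l e) ≡ suc (Vec.lookup e l)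
  length-baseProjection l e = trans (length-map (0ℤ ,′_) (interval (Vec.lookup e l))) (length-interval _)

  ∑-length-projection : ∀ {j} (w : Code j) → ∑ (λ l → length (projection l w)) ≡ D * suc j + Vec.sum (toVec w)
  ∑-length-projection (box e) = begin
    ∑ (λ l → length (baseProjection l e)) ≡⟨ cong sum (tabulate-cong (λ l → length-baseProjection l e)) ⟩
    ∑ (λ l → 1 + Vec.lookup e l)          ≡⟨ ∑-+ (λ _ → 1) (Vec.lookup e) ⟩
    ∑ {D} (λ _ → 1) + ∑ (Vec.lookup e)    ≡⟨ cong₂ _+_ (trans (∑-1 D) (sym (ℕP.*-identityʳ D))) (∑-lookup e) ⟩
    D * 1 + Vec.sum e                     ∎
    where open ≡-Reasoning
  ∑-length-projection {suc j} (layer o r w) = begin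
    ∑ (λ l → length (baseProjection l (o ⊞ r) ++ map (shiftπ (Vec.lookup o l)) (projection l w)))
      ≡⟨ cong sum (tabulate-cong λ l → trans (length-++ (baseProjection l (o ⊞ r)))
           (cong₂ _+_ (length-baseProjection l (o ⊞ r)) (length-map _ (projection l w)))) ⟩
    ∑ (λ l → (1 + Vec.lookup (o ⊞ r) l) + length (projection l w))
      ≡⟨ ∑-+ (λ l → 1 + Vec.lookup (o ⊞ r) l) (λ l → length (projection l w)) ⟩
    ∑ (λ l → 1 + Vec.lookup (o ⊞ r) l) + ∑ (λ l → length (projection l w))
      ≡⟨ cong₂ _+_ strata₀ (∑-length-projection w) ⟩
    (D + (Vec.sum o + Vec.sum r)) + (D * suc j + Vec.sum (toVec w))
      ≡⟨ interchange D (Vec.sum o + Vec.sum r) (D * suc j) (Vec.sum (toVec w)) ⟩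
    (D + D * suc j) + ((Vec.sum o + Vec.sum r) + Vec.sum (toVec w))
      ≡⟨ cong₂ _+_ (sym (ℕP.*-suc D (suc j))) (trans (ℕP.+-assoc (Vec.sum o) _ _) (sym sum-toVec)) ⟩
    D * suc (suc j) + Vec.sum (toVec (layer o r w)) ∎
    where
    open ≡-Reasoning
    strata₀ : ∑ (λ l → 1 + Vec.lookup (o ⊞ r) l) ≡ D + (Vec.sum o + Vec.sum r)
    strata₀ = begin
      ∑ (λ l → 1 + Vec.lookup (o ⊞ r) l)
        ≡⟨ ∑-+ (λ _ → 1) (Vec.lookup (o ⊞ r)) ⟩
      ∑ {D} (λ _ → 1) + ∑ (Vec.lookup (o ⊞ r))
        ≡⟨ cong₂ _+_ (∑-1 D) (cong sum (tabulate-cong λ l → VecP.lookup-zipWith _+_ l o r)) ⟩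
      D + ∑ (λ l → Vec.lookup o l + Vec.lookup r l)
        ≡⟨ cong (D ℕ.+_) (trans (∑-+ (Vec.lookup o) (Vec.lookup r)) (cong₂ _+_ (∑-lookup o) (∑-lookup r))) ⟩
      D + (Vec.sum o + Vec.sum r) ∎
    sum-toVec : Vec.sum (o Vec.++ r Vec.++ toVec w) ≡ Vec.sum o + (Vec.sum r + Vec.sum (toVec w))
    sum-toVec = trans (VecP.sum-++ o) (cong (Vec.sum o ℕ.+_) (VecP.sum-++ r))

  lateralArea-cells : ∀ {j} (w : Code j) → lateralArea (cells w) ≡ D * suc j + Vec.sum (toVec w)
  lateralArea-cells w = begin
    sum (map (projArea (cells w)) (List.tabulate suc)) ≡⟨ cong sum (map-tabulate suc (projArea (cells w))) ⟩
    ∑ (λ l → projArea (cells w) (suc l))               ≡⟨ cong sum (tabulate-cong (projArea-cells w)) ⟩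
    ∑ (λ l → length (projection l w))                  ≡⟨ ∑-length-projection w ⟩
    D * suc _ + Vec.sum (toVec w)                      ∎
    where open ≡-Reasoning

  module Rooted {P : CellSet (suc D)} {r₀ : ℤ} {rₜ : Vec ℤ D} (r∈P : (r₀ ∷ rₜ) ∈ P)
    (reach : ∀ c → c ∈ P → Path P (r₀ ∷ rₜ) c) (plateaus : AllPlateaus P) where

    r : Cell (suc D)
    r = r₀ ∷ rₜ

    Centred : Cell (suc D) → Set
    Centred c = c ⊕ r ∈ P

    Centred-nonneg : ∀ {c} → Centred c → 0ᵥ ≤ᵥ c
    Centred-nonneg {c} c∈ = ⊕-cancelˡ-≤ᵥ r (subst (_≤ᵥ c ⊕ r) (sym (0ᵥ⊕t≡t r)) (Path⇒≤ᵥ (reach _ c∈)))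

    top : Cell (suc D)
    top = Extrema.argmax first r P

    top∈P : top ∈ P
    top∈P with Extrema.argmax-sel first r P
    ... | inj₁ top≡r = subst (_∈ P) (sym top≡r) r∈P
    ... | inj₂ top∈  = top∈

    height : ℕ
    height = ℤ.∣ first top ℤ.- r₀ ∣

    height+r₀≡top : + height ℤ.+ r₀ ≡ first top
    height+r₀≡top = trans (cong (ℤ._+ r₀) (ℤP.0≤i⇒+∣i∣≡i (ℤP.i≤j⇒0≤j-i (≤ᵥ-first (Path⇒≤ᵥ (reach _ top∈P))))))
                          (i-j+j≡i (first top) r₀)

    Centred-bounded : ∀ {c} → Centred c → 0ℤ ℤ.≤ first c × first c ℤ.≤ + height
    Centred-bounded {x ∷ y} c∈ = ≤ᵥ-first (Centred-nonneg c∈) ,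
      +-cancelʳ-≤ᵢ r₀ (subst (x ℤ.+ r₀ ℤ.≤_) (sym height+r₀≡top)
        (All.lookup (Extrema.f[xs]≤f[argmax] {f = first} r P) c∈))

    level-inhabited : ∀ {a} → a ≤ height → Σ (Cell (suc D)) λ c → c ∈ P × first c ≡ + a ℤ.+ r₀
    level-inhabited {a} a≤h = Path-intermediate r∈P (reach top top∈P) (+ a ℤ.+ r₀)
      (ℤP.i≤j+i r₀ (+ a)) (subst (+ a ℤ.+ r₀ ℤ.≤_) height+r₀≡top (ℤP.+-monoˡ-≤ r₀ (+≤+ a≤h)))

    module Level {a} (a≤h : a ≤ height) where

      private
        witness : Σ (Cell (suc D)) λ c → c ∈ P × first c ≡ + a ℤ.+ r₀
        witness = level-inhabited a≤h
        plateau : Σ (Cell (suc D)) λ lo → Σ (Cell (suc D)) λ hi →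
          ∀ c → first c ≡ + a ℤ.+ r₀ → (c ∈ P ⇔ InBox lo hi c)
        plateau = plateaus (+ a ℤ.+ r₀) witness
        lo hi : Cell (suc D)
        lo = proj₁ plateau
        hi = proj₁ (proj₂ plateau)
        ∈P⇔InBox : ∀ c → first c ≡ + a ℤ.+ r₀ → (c ∈ P ⇔ InBox lo hi c)
        ∈P⇔InBox = proj₂ (proj₂ plateau)
        witness∈box : Within lo hi (proj₁ witness)
        witness∈box =
          Equivalence.to (InBox⇔Within ⇔-∘ ∈P⇔InBox _ (proj₂ (proj₂ witness))) (proj₁ (proj₂ witness))

      lower upper : Vec ℤ D
      lower = Vec.tail lo ⊖ rₜ
      upper = Vec.tail hi ⊖ rₜ

      nonempty : lower ≤ᵥ upper
      nonempty = ⊕-monoˡ-≤ᵥ _ (≤ᵥ-tail (≤ᵥ-trans (proj₁ witness∈box) (proj₂ witness∈box)))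

      stratum : ∀ y → Centred (+ a ∷ y) ⇔ Within lower upper y
      stratum y = Within-⊕⇔ rₜ ⇔-∘ (Within-∷⇔ {lo = lo} {hi} lo≤level level≤hi ⇔-∘
                    (InBox⇔Within ⇔-∘ ∈P⇔InBox ((+ a ∷ y) ⊕ r) refl))
        where
        lo≤level : first lo ℤ.≤ + a ℤ.+ r₀
        lo≤level = subst (first lo ℤ.≤_) (proj₂ (proj₂ witness)) (≤ᵥ-first (proj₁ witness∈box))
        level≤hi : + a ℤ.+ r₀ ℤ.≤ first hi
        level≤hi = subst (ℤ._≤ first hi) (proj₂ (proj₂ witness)) (≤ᵥ-first (proj₂ witness∈box))

    open Level using (lower; upper; stratum; nonempty)

    lower-0 : lower z≤n ≡ 0ᵥ
    lower-0 = ≤ᵥ-antisym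
      (proj₁ (Equivalence.to (stratum z≤n 0ᵥ) (subst (_∈ P) (sym (0ᵥ⊕t≡t r)) r∈P)))
      (≤ᵥ-tail (Centred-nonneg {+ 0 ∷ lower z≤n}
        (Equivalence.from (stratum z≤n (lower z≤n)) (≤ᵥ-refl , nonempty z≤n))))

    lower-least : ∀ {a} (a≤h : a ≤ height) z → z ∈ P → first z ≡ + a ℤ.+ r₀ → (+ a ∷ lower a≤h) ⊕ r ≤ᵥ z
    lower-least {a} a≤h (x ∷ y) z∈ x≡ = ℤP.≤-reflexive (sym x≡) ∷
      subst (lower a≤h ⊕ rₜ ≤ᵥ_) (x⊖t⊕t≡x y rₜ)
        (⊕-monoˡ-≤ᵥ rₜ (proj₁ (Equivalence.to (stratum a≤h (y ⊖ rₜ)) z∈′)))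
      where
      z∈′ : Centred (+ a ∷ y ⊖ rₜ)
      z∈′ = subst (_∈ P) (cong₂ _∷_ x≡ (sym (x⊖t⊕t≡x y rₜ))) z∈

    -- The least cell of level a + 1 is entered from level a, so lower (a + 1) lies on level a.
    supported : ∀ {a} (a<h : a < height) → Centred (+ a ∷ lower a<h)
    supported {a} a<h = predecessor∈P (Path-enters-from-below r∈P (reach _ m∈) r₀<m (lower-least a<h))
      where
      m∈ : Centred (+ suc a ∷ lower a<h)
      m∈ = Equivalence.from (stratum a<h (lower a<h)) (≤ᵥ-refl , nonempty a<h)
      r₀<m : r₀ ℤ.< + suc a ℤ.+ r₀
      r₀<m = ℤP.suc[i]≤j⇒i<j (ℤP.+-monoˡ-≤ r₀ (+≤+ (s≤s z≤n)))
      predecessor∈P : Σ (Cell (suc D)) (λ p → p ∈ P × (+ suc a ∷ lower a<h) ⊕ r ≡ updateAt p zero (ℤ._+ 1ℤ)) →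
        Centred (+ a ∷ lower a<h)
      predecessor∈P (p₀ ∷ pₜ , p∈ , m≡) = subst (_∈ P) (cong₂ _∷_ p₀≡ (sym (VecP.∷-injectiveʳ m≡))) p∈
        where
        p₀≡ : p₀ ≡ + a ℤ.+ r₀
        p₀≡ = +-cancelʳ-≡ᵢ 1ℤ (trans (sym (VecP.∷-injectiveˡ m≡))
                (trans (cong (ℤ._+ r₀) (+[1+a]≡+a+1 a)) (i+1+j≡i+j+1 (+ a) r₀)))

    stack : Stack height Centred
    stack = record
      { lower     = lower
      ; upper     = upper
      ; bounded   = Centred-bounded
      ; stratum   = stratum
      ; nonempty  = nonempty
      ; lower-0   = lower-0
      ; supported = supported
      }

    ∼cells : Σ (Code height) λ w → P ∼ cells w
    ∼cells with Stack⇒Code stack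
    ... | w , Centred⇔w = w , Vec.map ℤ.-_ r , λ c →
      ∈-cells⇔ w (c ⊖ r) ⇔-∘ (Centred⇔w (c ⊖ r) ⇔-∘
        mk⇔ (subst (_∈ P) (sym (x⊖t⊕t≡x c r))) (subst (_∈ P) (x⊖t⊕t≡x c r)))

  DirectedPlateau⇒∼cells : ∀ {P : CellSet (suc D)} → DirectedPlateau P → Σ ℕ λ j → Σ (Code j) λ w → P ∼ cells w
  DirectedPlateau⇒∼cells ((_ ∷ _ , r∈P , reach) , plateaus) = _ , Rooted.∼cells r∈P reach plateaus

  cells-DPP : ∀ {j} (w : Code j) → DPP (suc D) (suc j) (D * suc j + Vec.sum (toVec w)) (cells w)
  cells-DPP w = (Stack⇒Directed (cells-stack w) , Stack⇒AllPlateaus (cells-stack w)) ,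
                Stack⇒width (cells-stack w) , lateralArea-cells w

  codes : ∀ j → ℕ → List (Code j)
  codes j m = map (fromVec j) (compositions (size j) m)

  codes-unique : ∀ j m → Unique (codes j m)
  codes-unique j m = Unique.map⁺ fromVec-injective (compositions-unique (size j) m)
    where
    fromVec-injective : ∀ {v v′} → fromVec j v ≡ fromVec j v′ → v ≡ v′
    fromVec-injective {v} {v′} eq =
      trans (sym (toVec-fromVec j v)) (trans (cong toVec eq) (toVec-fromVec j v′))

  ∈-codes⁺ : ∀ {j m} (w : Code j) → Vec.sum (toVec w) ≡ m → w ∈ codes j m
  ∈-codes⁺ {j} {m} w Σw≡m = subst (_∈ codes j m) (fromVec-toVec w)
    (∈-map⁺ (fromVec j) (∈-compositions⁺ (size j) m (toVec w) Σw≡m))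

  ∈-codes⁻ : ∀ {j m} {w : Code j} → w ∈ codes j m → Vec.sum (toVec w) ≡ m
  ∈-codes⁻ {j} {m} w∈ with ∈-map⁻ (fromVec j) w∈
  ... | v , v∈ , refl = trans (cong Vec.sum (toVec-fromVec j v)) (∈-compositions⁻ (size j) m v∈)

module Counting (D′ : ℕ) where

  D : ℕ
  D = suc D′

  open Stacks D

  size≡ : ∀ j → size j ≡ suc (D′ + D * (j + j))
  size≡ zero    = cong suc (sym (trans (cong (D′ ℕ.+_) (ℕP.*-zeroʳ D)) (ℕP.+-identityʳ D′)))
  size≡ (suc j) = trans (cong (λ s → D + (D + s)) (size≡ j)) (size-step D′ j)
    where
    size-step : ∀ D′ j → suc D′ + (suc D′ + suc (D′ + suc D′ * (j + j))) ≡ suc (D′ + suc D′ * (suc j + suc j))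
    size-step = solve-∀ℕ

  length-codes : ∀ j m → length (codes j m) ≡ (m + (D′ + D * (j + j))) C m
  length-codes j m = trans (length-map (fromVec j) (compositions (size j) m))
    (subst (λ p → length (compositions p m) ≡ (m + (D′ + D * (j + j))) C m) (sym (size≡ j))
      (length-compositions _ m))

  NumClasses-DPP : ∀ j n → D * suc j ≤ n →
    NumClasses _∼_ (DPP (suc D) (suc j) n) ((n + D * suc j ∸ suc D) C (n ∸ D * suc j))
  NumClasses-DPP j n Dk≤n =
    subst (NumClasses _∼_ (DPP (suc D) (suc j) n)) (trans (length-codes j m) (cong (_C m) exponent≡))
      (NumClasses-enumeration {_≈_ = _∼_} {S = DPP (suc D) (suc j) n}
        cells (codes j m) (codes-unique j m) codes-DPP cells-injective cover)
    where
    m = n ∸ D * suc j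
    n≡ : D * suc j + m ≡ n
    n≡ = ℕP.m+[n∸m]≡n Dk≤n
    codes-DPP : ∀ {w} → w ∈ codes j m → DPP (suc D) (suc j) n (cells w)
    codes-DPP {w} w∈ = subst (λ a → DPP (suc D) (suc j) a (cells w))
      (trans (cong (D * suc j ℕ.+_) (∈-codes⁻ w∈)) n≡) (cells-DPP w)
    cover : ∀ P → DPP (suc D) (suc j) n P → Σ (Code j) λ w → w ∈ codes j m × P ∼ cells w
    cover P (dp , widthP , areaP) with DirectedPlateau⇒∼cells dp
    ... | j′ , w , P∼w
      with refl ← ℕP.suc-injective (trans (sym (Stack⇒width (cells-stack w))) (trans (width-∼ P∼w) widthP)) =
      w , ∈-codes⁺ w (trans (sym (ℕP.m+n∸m≡n (D * suc j) _))
            (cong (_∸ D * suc j) (trans (sym (lateralArea-cells w)) (trans (lateralArea-∼ P∼w) areaP)))) , P∼w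
    exponent≡ : m + (D′ + D * (j + j)) ≡ n + D * suc j ∸ suc D
    exponent≡ = trans (sym (ℕP.m+n∸n≡m _ (suc D)))
      (cong (_∸ suc D) (trans (shuffle D′ j m) (cong (ℕ._+ D * suc j) n≡)))
      where
      shuffle : ∀ D′ j m → m + (D′ + suc D′ * (j + j)) + suc (suc D′) ≡ suc D′ * suc j + m + suc D′ * suc j
      shuffle = solve-∀ℕ

-- The argument works for every d ≥ 2; the hypothesis 3 ≤ d is only used to exclude d ≤ 1.
theorem3 : (d k n : ℕ) → 3 ≤ d → 1 ≤ k → (d ∸ 1) * k ≤ n →
    NumClasses _∼_ (DPP d k n) ((n + (d ∸ 1) * k ∸ d) C (n ∸ (d ∸ 1) * k))
theorem3 (suc (suc D′)) (suc j) n _ _ hyp = Counting.NumClasses-DPP D′ j n hyp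
theorem3 (suc zero) _ _ (s≤s ()) _ _
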